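{- Let $J$ be a set of join-irreducible permutations in the weak order on permutations of $\{1,\ldots,n\}$, and let $\mathcal{E}$ be the corresponding collection of arcs. The following are equivalent: (i) $J$ is the canonical join representation of a permutation; (ii) there is a noncrossing arc diagram whose arcs are combinatorially equivalent to the arcs in $\mathcal{E}$; (iii) the arcs in $\mathcal{E}$ are pairwise compatible; (iv) each $2$-element subset of $J$ is the canonical join representation of a permutation.
   Context: Weak order: $x\le y$ iff $\operatorname{inv}(x)\subseteq\operatorname{inv}(y)$, where $\operatorname{inv}(x)$ is the set of pairs $(x_i,x_j)$ with $i<j$, $x_i>x_j$. A permutation is join-irreducible iff it has exactly one descent. A set $J$ "is the canonical join representation of $x$" means $x=\bigvee J$ is irredundant and for every $T$ with $\bigvee T=x$ each element of $J$ lies below some element of $T$. Arcs: on points $1,\ldots,n$ bottom to top on a vertical line, an arc joins $p<q$ moving monotonically upward and passing left or right of each intermediate point; arcs are combinatorially equivalent when they have the same endpoints and the same intermediate points on their left. A join-irreducible permutation with descent $b>a$ corresponds to the arc joining $a$ and $b$ having each $c$ with $a<c<b$ on its left iff $c$ precedes the descent in the permutation. A noncrossing arc diagram is a collection of arcs with no two intersecting except at endpoints and no two sharing an upper endpoint or a lower endpoint. Two arcs are compatible if some noncrossing arc diagram contains both. -}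

module Defs where

open import Data.Nat as ℕ using (ℕ; suc)
open import Data.Fin as Fin using (Fin; toℕ; _≤?_)
open import Data.Integer as ℤ using (ℤ; 0ℤ)
open import Data.Bool using (Bool; true; false; if_then_else_)
open import Data.List using (List; []; _∷_; length)
open import Data.List.Relation.Unary.All using (All; []; _∷_)
open import Data.List.Relation.Unary.Any using (Any)
open import Data.Unit using (⊤)
open import Data.Product using (Σ; Σ-syntax; _×_; _,_)
open import Data.Fin.Permutation using (Permutation′; _⟨$⟩ʳ_; _⟨$⟩ˡ_)
open import Relation.Binary.PropositionalEquality using (_≡_; _≢_)
open import Relation.Nullary using (¬_)
open import Relation.Nullary.Decidable using (⌊_⌋)

-- Permutations of {1,…,n}, encoded on Fin n (value k ↔ k+1).
-- A permutation x is read in one-line notation: x ⟨$⟩ʳ i is the entry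
-- at position i; x ⟨$⟩ˡ v is the position of the value v.

Perm : ℕ → Set
Perm n = Permutation′ n

_≈ₚ_ : ∀ {n} → Perm n → Perm n → Set
x ≈ₚ y = ∀ i → x ⟨$⟩ʳ i ≡ y ⟨$⟩ʳ i

_∈ₚ_ : ∀ {n} → Perm n → List (Perm n) → Set
w ∈ₚ L = Any (w ≈ₚ_) L

_⊆ₚ_ : ∀ {n} → List (Perm n) → List (Perm n) → Set
S ⊆ₚ T = All (_∈ₚ T) S

Inv : ∀ {n} → Perm n → Fin n → Fin n → Set
Inv x p q = Σ[ i ∈ Fin _ ] Σ[ j ∈ Fin _ ]
  (i Fin.< j × x ⟨$⟩ʳ i ≡ p × x ⟨$⟩ʳ j ≡ q × q Fin.< p)

_≤w_ : ∀ {n} → Perm n → Perm n → Set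
x ≤w y = ∀ p q → Inv x p q → Inv y p q

IsJoin : ∀ {n} → List (Perm n) → Perm n → Set
IsJoin {n} T x = All (_≤w x) T × (∀ (z : Perm n) → All (_≤w z) T → x ≤w z)

Irredundant : ∀ {n} → List (Perm n) → Perm n → Set
Irredundant {n} J x = ∀ (T : List (Perm n)) → T ⊆ₚ J → IsJoin T x → J ⊆ₚ T

IsCanonicalJoinRep : ∀ {n} → List (Perm n) → Perm n → Set
IsCanonicalJoinRep {n} J x =
  IsJoin J x × Irredundant J x ×
  (∀ (T : List (Perm n)) → IsJoin T x → All (λ j → Any (j ≤w_) T) J)

Distinct : ∀ {n} → List (Perm n) → Set
Distinct [] = ⊤
Distinct (w ∷ J) = All (λ v → ¬ (w ≈ₚ v)) J × Distinct J

Descent : ∀ {n} → Perm n → Fin n → Set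
Descent x i = Σ[ j ∈ Fin _ ] (toℕ j ≡ suc (toℕ i) × x ⟨$⟩ʳ j Fin.< x ⟨$⟩ʳ i)

JoinIrreducible : ∀ {n} → Perm n → Set
JoinIrreducible x = Σ[ i ∈ Fin _ ] (Descent x i × (∀ i′ → Descent x i′ → i′ ≡ i))

-- Combinatorial arcs on points 1,…,n (again encoded by Fin n).
-- An arc is given by its endpoints and, for each point c, whether c is
-- on its left (only relevant for bot < c < top).

record Arc (n : ℕ) : Set where
  field
    bot top : Fin n
    bot<top : bot Fin.< top
    left    : Fin n → Bool
open Arc public

Between : ∀ {n} → Arc n → Fin n → Set
Between α c = bot α Fin.< c × c Fin.< top α

_≈ₐ_ : ∀ {n} → Arc n → Arc n → Set
α ≈ₐ β = bot α ≡ bot β × top α ≡ top β × (∀ c → Between α c → left α c ≡ left β c)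

arcOf : ∀ {n} (x : Perm n) → JoinIrreducible x → Arc n
arcOf x (i , (j , _ , xj<xi) , _) = record
  { bot = x ⟨$⟩ʳ j ; top = x ⟨$⟩ʳ i ; bot<top = xj<xi
  ; left = λ c → ⌊ (x ⟨$⟩ˡ c) ≤? i ⌋ }

arcsOf : ∀ {n} (J : List (Perm n)) → All JoinIrreducible J → List (Arc n)
arcsOf [] [] = []
arcsOf (x ∷ J) (jx ∷ js) = arcOf x jx ∷ arcsOf J js

-- Heights: level 2k is the height of point k, level 2k+1 lies strictly
-- between points k and k+1.  The points lie on the vertical line x = 0.
-- A drawn arc is described by its horizontal position at every level of
-- its height range; the curve is the piecewise-linear interpolation.

lvl : ∀ {n} → Fin n → ℕ
lvl c = 2 ℕ.* toℕ c

Inside : ∀ {n} → Arc n → ℕ → Set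
Inside α ℓ = lvl (bot α) ℕ.< ℓ × ℓ ℕ.< lvl (top α)

Within : ∀ {n} → Arc n → ℕ → Set
Within α ℓ = lvl (bot α) ℕ.≤ ℓ × ℓ ℕ.≤ lvl (top α)

record NoncrossingArcDiagram (n : ℕ) : Set where
  field
    arcs : List (Arc n)
  A : Set
  A = Fin (length arcs)
  arc : A → Arc n
  arc e = Data.List.lookup arcs e
  field
    pos : A → ℕ → ℤ
    distinct-top : ∀ e f → top (arc e) ≡ top (arc f) → e ≡ f
    distinct-bot : ∀ e f → bot (arc e) ≡ bot (arc f) → e ≡ f
    at-bot : ∀ e → pos e (lvl (bot (arc e))) ≡ 0ℤ
    at-top : ∀ e → pos e (lvl (top (arc e))) ≡ 0ℤ
    sides : ∀ e c → Between (arc e) c →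
      (if left (arc e) c then pos e (lvl c) ℤ.< 0ℤ else 0ℤ ℤ.< pos e (lvl c))
    apart : ∀ e f → e ≢ f → ∀ ℓ → Inside (arc e) ℓ → Inside (arc f) ℓ →
      pos e ℓ ≢ pos f ℓ
    no-swap : ∀ e f ℓ → Within (arc e) ℓ → Within (arc e) (suc ℓ) →
      Within (arc f) ℓ → Within (arc f) (suc ℓ) →
      ¬ (pos e ℓ ℤ.< pos f ℓ × pos f (suc ℓ) ℤ.< pos e (suc ℓ))
open NoncrossingArcDiagram public

Compatible : ∀ {n} → Arc n → Arc n → Set
Compatible {n} α β = Σ[ D ∈ NoncrossingArcDiagram n ]
  (Any (α ≈ₐ_) (arcs D) × Any (β ≈ₐ_) (arcs D))

{-# OPTIONS --safe #-}
module Submission where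

-- A permutation is determined by its inversion set, and the inversion sets are exactly the
-- decidable relations inside _>_ that are transitive and cotransitive.  Hence joins are
-- transitive closures of unions of inversion sets, and every permutation x is the join of the
-- join-irreducibles of its descents; a chain of inversions across a descent x d > x (d + 1)
-- has a single step, which makes these join-irreducibles the canonical join representation.
-- The join-irreducible of an arc inverts exactly the pairs (a , b) with a left of (or the top
-- of) the arc and b right of (or the bottom of) it.  Conversely, a chain of inversions of
-- pairwise uncrossed arcs never passes from the right of one of them to its left, so the
-- transitive closure of their union is the inversion set of a permutation whose descents are
-- exactly these arcs.  Drawing the arc of the descent at position d through the height of c at
-- abscissa 2 · (position of c) − (2 d + 1) gives a noncrossing diagram, and two arcs of a
-- noncrossing diagram keep their left-to-right order, so they are uncrossed.  Condition (iv)
-- is (i) ⇔ (iii) for two-element lists.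

open import Defs
open import Data.Bool using (true; false; if_then_else_)
import Data.Bool.Properties as Boolₚ
open import Data.Empty using (⊥; ⊥-elim)
open import Data.Fin as Fin using (Fin; toℕ; fromℕ<; zero; suc; _<_; _≤_; _>_; _≟_; _<?_; _≤?_)
open import Data.Fin.Induction using (<-weakInduction; >-wellFounded)
open import Data.Fin.Permutation using (permutation; _⟨$⟩ʳ_; _⟨$⟩ˡ_; inverseˡ; inverseʳ)
import Data.Fin.Properties as Finₚ
open import Data.Fin.Subset using (Subset; _∈_; ∣_∣)
import Data.Fin.Subset.Properties as Subsetₚ
open import Data.Integer as ℤ using (ℤ; 0ℤ; _⊖_)
import Data.Integer.Properties as ℤₚ
open import Data.List using (List; []; _∷_; length; lookup; filter; tabulate)
open import Data.List.Membership.Propositional.Properties using (∈-lookup; ∈-filter⁺; ∈-filter⁻)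
open import Data.List.Properties using (tabulate-lookup)
open import Data.List.Relation.Binary.Pointwise as Pointwise using (Pointwise; []; _∷_)
open import Data.List.Relation.Unary.All as All using (All; []; _∷_)
import Data.List.Relation.Unary.All.Properties as Allₚ
open import Data.List.Relation.Unary.AllPairs using (AllPairs; []; _∷_)
import Data.List.Relation.Unary.AllPairs.Properties as AllPairsₚ
open import Data.List.Relation.Unary.Any as Any using (Any; here; there)
import Data.List.Relation.Unary.Any.Properties as Anyₚ
open import Data.Nat as ℕ using (ℕ; zero; suc; z≤n; s≤s; _+_; _*_; _∸_; ⌊_/2⌋)
open import Data.Nat.Induction using () renaming (<-wellFounded to ℕ-<-wellFounded)
import Data.Nat.Properties as ℕₚ
open import Data.Nat.Tactic.RingSolver using (solve-∀)
open import Data.Product using (Σ; Σ-syntax; ∃; _×_; _,_; _,′_; proj₁; proj₂)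
open import Data.Sum as Sum using (_⊎_; inj₁; inj₂; [_,_]′)
open import Data.Unit using (tt)
import Data.Vec as Vec
open import Data.Vec.Properties using (lookup⇒[]=; []=⇒lookup; lookup∘tabulate)
open import Function using (_∘_; case_of_)
open import Function.Bundles using (_⇔_; mk⇔)
open import Induction.WellFounded using (Acc; acc)
open import Level using (0ℓ)
open import Relation.Binary.Construct.Closure.Transitive using (TransClosure; [_]; _∷_; _++_; _∷ʳ_)
open import Relation.Binary.Core using (Rel; _⇒_)
open import Relation.Binary.Definitions using (Decidable; Trichotomous; tri<; tri≈; tri>)
open import Relation.Binary.PropositionalEquality
open import Relation.Binary.Structures using (IsStrictTotalOrder)
open import Relation.Nullary using (¬_; ¬?; Dec; yes; no; contradiction)
open import Relation.Nullary.Decidable as Dec using (⌊_⌋; isYes≗does; dec-true; dec-false; decidable-stable; _×-dec_)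

All-lookup : ∀ {A : Set} {P : A → Set} {xs : List A} → All P xs → ∀ e → P (lookup xs e)
All-lookup pxs e = All.lookup pxs (∈-lookup e)

All-tabulate : ∀ {A : Set} {P : A → Set} {xs : List A} → (∀ e → P (lookup xs e)) → All P xs
All-tabulate {P = P} f = All.tabulate λ x∈ → subst P (sym (Anyₚ.lookup-index x∈)) (f (Any.index x∈))

Any-×-All : ∀ {A : Set} {P Q : A → Set} {xs : List A} → Any P xs → All Q xs → Any (λ x → P x × Q x) xs
Any-×-All (here p) (q ∷ _) = here (p , q)
Any-×-All (there p) (_ ∷ qs) = there (Any-×-All p qs)

AllPairs-lookup : ∀ {A : Set} {R : A → A → Set} {xs : List A} → AllPairs R xs →
  ∀ {e f} → e < f → R (lookup xs e) (lookup xs f)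
AllPairs-lookup (Rx ∷ _) {zero} {suc f} _ = All-lookup Rx f
AllPairs-lookup (_ ∷ Rxs) {suc e} {suc f} (s≤s e<f) = AllPairs-lookup Rxs e<f

AllPairs-tabulate : ∀ {A : Set} {R : A → A → Set} {xs : List A} →
  (∀ {e f} → e < f → R (lookup xs e) (lookup xs f)) → AllPairs R xs
AllPairs-tabulate {R = R} {xs} R-lookup = subst (AllPairs R) (tabulate-lookup xs) (AllPairsₚ.tabulate⁺-< R-lookup)

AllPairs-from-All : ∀ {A : Set} {P : A → Set} {R : A → A → Set} {xs : List A} →
  (∀ {a b} → P a → P b → R a b) → All P xs → AllPairs R xs
AllPairs-from-All P⇒R [] = []
AllPairs-from-All P⇒R (Pa ∷ Pas) = All.map (P⇒R Pa) Pas ∷ AllPairs-from-All P⇒R Pas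

Pointwise⇒All-Any : ∀ {A : Set} {R : A → A → Set} {xs ys : List A} → Pointwise R xs ys → All (λ y → Any (λ x → R x y) xs) ys
Pointwise⇒All-Any [] = []
Pointwise⇒All-Any (Rxy ∷ Rxsys) = here Rxy ∷ All.map there (Pointwise⇒All-Any Rxsys)

⊖-neg : ∀ {m n} → m ℕ.< n → m ⊖ n ℤ.< 0ℤ
⊖-neg {m} {n} m<n = subst (m ⊖ n ℤ.<_) (ℤₚ.n⊖n≡0 n) (ℤₚ.⊖-monoˡ-< n m<n)

⊖-pos : ∀ {m n} → n ℕ.< m → 0ℤ ℤ.< m ⊖ n
⊖-pos {m} {n} n<m = subst (ℤ._< m ⊖ n) (ℤₚ.n⊖n≡0 n) (ℤₚ.⊖-monoˡ-< n n<m)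

⊖-≤ : ∀ {m n m′ n′} → m + n′ ℕ.≤ m′ + n → m ⊖ n ℤ.≤ m′ ⊖ n′
⊖-≤ {m} {n} {m′} {n′} le =
  subst₂ ℤ._≤_ (ℤₚ.+-cancelˡ-⊖ n′ m n) (trans (cong ((n + m′) ⊖_) (ℕₚ.+-comm n′ n)) (ℤₚ.+-cancelˡ-⊖ n m′ n′))
    (ℤₚ.⊖-monoˡ-≤ (n′ + n) (subst₂ ℕ._≤_ (ℕₚ.+-comm m n′) (ℕₚ.+-comm m′ n) le))

⊖-injectiveʳ : ∀ p {m n} → p ⊖ m ≡ p ⊖ n → m ≡ n
⊖-injectiveʳ p {m} {n} eq with ℕₚ.<-cmp m n
... | tri< m<n _ _ = contradiction (sym eq) (ℤₚ.<⇒≢ (ℤₚ.⊖-monoʳ->-< p m<n))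
... | tri≈ _ m≡n _ = m≡n
... | tri> _ _ n<m = contradiction eq (ℤₚ.<⇒≢ (ℤₚ.⊖-monoʳ->-< p n<m))

injective⇒surjective : ∀ {n} {f : Fin n → Fin n} → (∀ {a b} → f a ≡ f b → a ≡ b) →
  ∀ i → ∃ λ a → f a ≡ i
injective⇒surjective {suc n} {f} f-inj i with Finₚ.any? (λ a → f a ≟ i)
... | yes hit = hit
... | no miss = contradiction (Finₚ.injective⇒≤ avoid-i-injective) ℕₚ.1+n≰n
  where
  avoid-i : Fin (suc n) → Fin n
  avoid-i a = Fin.punchOut {i = i} (λ i≡fa → miss (a , sym i≡fa))

  avoid-i-injective : ∀ {a b} → avoid-i a ≡ avoid-i b → a ≡ b
  avoid-i-injective eq = f-inj (Finₚ.punchOut-injective {i = i} _ _ eq)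

increasing⇒inflationary : ∀ {n} (f : Fin n → Fin n) → (∀ {i j} → i < j → f i < f j) → ∀ i → i ≤ f i
increasing⇒inflationary {suc n} f f-mono = <-weakInduction (λ i → i ≤ f i) z≤n step
  where
  step : ∀ i → Fin.inject₁ i ≤ f (Fin.inject₁ i) → suc i ≤ f (suc i)
  step i ih = ℕₚ.≤-<-trans (subst (ℕ._≤ toℕ (f (Fin.inject₁ i))) (Finₚ.toℕ-inject₁ i) ih)
                           (f-mono (Finₚ.≤̄⇒inject₁< Finₚ.≤-refl))

trichotomous : ∀ {n} {R : Rel (Fin n) 0ℓ} → (∀ {a} → ¬ R a a) → (∀ {a b c} → R a b → R b c → R a c) →
  (∀ {a b} → a ≢ b → R a b ⊎ R b a) → Trichotomous _≡_ R
trichotomous irr trans connex a b with a ≟ b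
... | yes refl = tri≈ irr refl irr
... | no a≢b with connex a≢b
...   | inj₁ r = tri< r a≢b (irr ∘ trans r)
...   | inj₂ r = tri> (irr ∘ trans r) a≢b r

⌊⌋-true⁻ : ∀ {A : Set} (a? : Dec A) → ⌊ a? ⌋ ≡ true → A
⌊⌋-true⁻ (yes a) _ = a

⌊⌋-false⁻ : ∀ {A : Set} (a? : Dec A) → ⌊ a? ⌋ ≡ false → ¬ A
⌊⌋-false⁻ (no ¬a) _ = ¬a

⌊⌋-true⁺ : ∀ {A : Set} (a? : Dec A) → A → ⌊ a? ⌋ ≡ true
⌊⌋-true⁺ a? a = trans (isYes≗does a?) (dec-true a? a)

⌊⌋-false⁺ : ∀ {A : Set} (a? : Dec A) → ¬ A → ⌊ a? ⌋ ≡ false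
⌊⌋-false⁺ a? ¬a = trans (isYes≗does a?) (dec-false a? ¬a)

≡true⇒≢false : ∀ {b} → b ≡ true → b ≡ false → ⊥
≡true⇒≢false refl ()

bool-cases : ∀ b → b ≡ false ⊎ b ≡ true
bool-cases false = inj₁ refl
bool-cases true  = inj₂ refl

Before : ∀ {n} → Perm n → Rel (Fin n) 0ℓ
Before x a b = x ⟨$⟩ˡ a < x ⟨$⟩ˡ b

module _ {n} (x : Perm n) where

  ⟨$⟩ˡ-injective : ∀ {a b} → x ⟨$⟩ˡ a ≡ x ⟨$⟩ˡ b → a ≡ b
  ⟨$⟩ˡ-injective {a} {b} eq = begin
    a                    ≡⟨ inverseʳ x ⟨
    x ⟨$⟩ʳ (x ⟨$⟩ˡ a)    ≡⟨ cong (x ⟨$⟩ʳ_) eq ⟩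
    x ⟨$⟩ʳ (x ⟨$⟩ˡ b)    ≡⟨ inverseʳ x ⟩
    b                    ∎
    where open ≡-Reasoning

  ⟨$⟩ʳ-injective : ∀ {i j} → x ⟨$⟩ʳ i ≡ x ⟨$⟩ʳ j → i ≡ j
  ⟨$⟩ʳ-injective eq = trans (sym (inverseˡ x)) (trans (cong (x ⟨$⟩ˡ_) eq) (inverseˡ x))

  Before-connex : ∀ {a b} → a ≢ b → Before x a b ⊎ Before x b a
  Before-connex a≢b with Finₚ.<-cmp (x ⟨$⟩ˡ _) (x ⟨$⟩ˡ _)
  ... | tri< lt _ _ = inj₁ lt
  ... | tri≈ _ eq _ = contradiction (⟨$⟩ˡ-injective eq) a≢b
  ... | tri> _ _ gt = inj₂ gt

  Inv⇒Before : ∀ {a b} → Inv x a b → Before x a b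
  Inv⇒Before (i , j , i<j , refl , refl , _) = subst₂ _<_ (sym (inverseˡ x)) (sym (inverseˡ x)) i<j

  Inv⇒> : ∀ {a b} → Inv x a b → b < a
  Inv⇒> (_ , _ , _ , _ , _ , b<a) = b<a

  Before⇒Inv : ∀ {a b} → Before x a b → b < a → Inv x a b
  Before⇒Inv {a} {b} before b<a = x ⟨$⟩ˡ a , x ⟨$⟩ˡ b , before , inverseʳ x , inverseʳ x , b<a

  Inv? : Decidable (Inv x)
  Inv? a b with x ⟨$⟩ˡ a <? x ⟨$⟩ˡ b | b <? a
  ... | yes before | yes b<a = yes (Before⇒Inv before b<a)
  ... | no ¬before | _       = no (¬before ∘ Inv⇒Before)
  ... | _          | no b≮a  = no (b≮a ∘ Inv⇒>)

≈ₚ-sym : ∀ {n} {x y : Perm n} → x ≈ₚ y → y ≈ₚ x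
≈ₚ-sym x≈y i = sym (x≈y i)

Inv-resp-≈ₚ : ∀ {n} {x y : Perm n} → x ≈ₚ y → Inv x ⇒ Inv y
Inv-resp-≈ₚ x≈y (i , j , i<j , refl , refl , lt) = i , j , i<j , sym (x≈y i) , sym (x≈y j) , lt

_≈ₚ?_ : ∀ {n} → Decidable (_≈ₚ_ {n})
x ≈ₚ? y = Finₚ.all? (λ i → x ⟨$⟩ʳ i ≟ y ⟨$⟩ʳ i)

Distinct-lookup : ∀ {n} {J : List (Perm n)} → Distinct J → ∀ {e f} → e ≢ f → ¬ lookup J e ≈ₚ lookup J f
Distinct-lookup {J = _ ∷ _} _ {zero} {zero} e≢f = contradiction refl e≢f
Distinct-lookup {J = _ ∷ _} (distinct , _) {zero} {suc f} _ = All-lookup distinct f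
Distinct-lookup {J = _ ∷ _} (distinct , _) {suc e} {zero} _ eq = All-lookup distinct e (λ i → sym (eq i))
Distinct-lookup {J = _ ∷ _} (_ , J-distinct) {suc e} {suc f} e≢f = Distinct-lookup J-distinct (e≢f ∘ cong suc)

-- Inversion sets

record IsInversionSet {n} (I : Rel (Fin n) 0ℓ) : Set where
  field
    dec          : Decidable I
    descending   : ∀ {a b} → I a b → b < a
    transitive   : ∀ {a b c} → I a b → I b c → I a c
    cotransitive : ∀ {a b c} → I a c → c < b → b < a → I a b ⊎ I b c

Inv-isInversionSet : ∀ {n} (x : Perm n) → IsInversionSet (Inv x)
Inv-isInversionSet x = record
  { dec          = Inv? x
  ; descending   = Inv⇒> x
  ; transitive   = λ ab bc → Before⇒Inv x (Finₚ.<-trans (Inv⇒Before x ab) (Inv⇒Before x bc))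
                                           (Finₚ.<-trans (Inv⇒> x bc) (Inv⇒> x ab))
  ; cotransitive = cotrans
  }
  where
  cotrans : ∀ {a b c} → Inv x a c → c < b → b < a → Inv x a b ⊎ Inv x b c
  cotrans {a} {b} ac c<b b<a with Before-connex x {a} {b} (Finₚ.<⇒≢ b<a ∘ sym)
  ... | inj₁ ab = inj₁ (Before⇒Inv x ab b<a)
  ... | inj₂ ba = inj₂ (Before⇒Inv x (Finₚ.<-trans ba (Inv⇒Before x ac)) c<b)

-- The order in which a permutation with inversion set I lists its values.
Precedes : ∀ {n} → Rel (Fin n) 0ℓ → Rel (Fin n) 0ℓ
Precedes I a b = (b < a × I a b) ⊎ (a < b × ¬ I b a)

Before⇒Precedes : ∀ {n} (x : Perm n) {a b} → Before x a b → Precedes (Inv x) a b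
Before⇒Precedes x {a} {b} before with Finₚ.<-cmp a b
... | tri< a<b _ _ = inj₂ (a<b , λ ba → Finₚ.<-asym before (Inv⇒Before x ba))
... | tri≈ _ refl _ = contradiction before (Finₚ.<-irrefl refl)
... | tri> _ _ b<a = inj₁ (b<a , Before⇒Inv x before b<a)

Precedes⇒Before : ∀ {n} (x : Perm n) {a b} → Precedes (Inv x) a b → Before x a b
Precedes⇒Before x (inj₁ (_ , ab)) = Inv⇒Before x ab
Precedes⇒Before x (inj₂ (a<b , ¬ba)) with Before-connex x (Finₚ.<⇒≢ a<b)
... | inj₁ before = before
... | inj₂ after = contradiction (Before⇒Inv x after a<b) ¬ba

Before-transfer : ∀ {n} (x y : Perm n) → x ≤w y → y ≤w x → ∀ {a b} → Before x a b → Before y a b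
Before-transfer x y x≤y y≤x before with Before⇒Precedes x before
... | inj₁ (b<a , ab) = Inv⇒Before y (x≤y _ _ ab)
... | inj₂ (a<b , ¬ba) = Precedes⇒Before y (inj₂ (a<b , ¬ba ∘ y≤x _ _))

-- Permutations with the same inversions list their values in the same order, so
-- x⁻¹ ∘ y is an increasing bijection of Fin n, hence the identity.
Inv-injective : ∀ {n} (x y : Perm n) → x ≤w y → y ≤w x → x ≈ₚ y
Inv-injective {n} x y x≤y y≤x i = begin
  x ⟨$⟩ʳ i                     ≡⟨ cong (x ⟨$⟩ʳ_) (sym (relabel-fixes x y x≤y y≤x)) ⟩
  x ⟨$⟩ʳ (x ⟨$⟩ˡ (y ⟨$⟩ʳ i))   ≡⟨ inverseʳ x ⟩
  y ⟨$⟩ʳ i                     ∎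
  where
  open ≡-Reasoning
  relabel : Perm n → Perm n → Fin n → Fin n
  relabel u v j = u ⟨$⟩ˡ (v ⟨$⟩ʳ j)

  relabel-increasing : ∀ u v → u ≤w v → v ≤w u → ∀ {j k} → j < k → relabel u v j < relabel u v k
  relabel-increasing u v u≤v v≤u j<k =
    Before-transfer v u v≤u u≤v (subst₂ _<_ (sym (inverseˡ v)) (sym (inverseˡ v)) j<k)

  relabel-fixes : ∀ u v → u ≤w v → v ≤w u → relabel u v i ≡ i
  relabel-fixes u v u≤v v≤u = Finₚ.≤-antisym
    (subst (relabel u v i ≤_) (trans (cong (v ⟨$⟩ˡ_) (inverseʳ u)) (inverseˡ v))
      (increasing⇒inflationary (relabel v u) (relabel-increasing v u v≤u u≤v) (relabel u v i)))
    (increasing⇒inflationary (relabel u v) (relabel-increasing u v u≤v v≤u) i)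

-- The permutation listing the values of Fin n in increasing R-order: the position of a
-- is the number of R-predecessors of a.
module Ordering {n} {R : Rel (Fin n) 0ℓ} (R-isStrictTotalOrder : IsStrictTotalOrder _≡_ R) where
  open IsStrictTotalOrder R-isStrictTotalOrder using (irrefl; compare) renaming (trans to R-trans; _<?_ to _R?_)

  predecessors : Fin n → Subset n
  predecessors a = Vec.tabulate (λ b → ⌊ b R? a ⌋)

  predecessors⁺ : ∀ {a b} → R b a → b ∈ predecessors a
  predecessors⁺ {a} {b} r = lookup⇒[]= b _ (trans (lookup∘tabulate _ b) (⌊⌋-true⁺ (b R? a) r))

  predecessors⁻ : ∀ {a b} → b ∈ predecessors a → R b a
  predecessors⁻ {a} {b} b∈ = ⌊⌋-true⁻ (b R? a) (trans (sym (lookup∘tabulate _ b)) ([]=⇒lookup b∈))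

  rank : Fin n → Fin n
  rank a = fromℕ< (subst (∣ predecessors a ∣ ℕ.<_) (Subsetₚ.∣⊤∣≡n n)
             (Subsetₚ.p⊂q⇒∣p∣<∣q∣ (Subsetₚ.⊆⊤ , a , Subsetₚ.∈⊤ , irrefl refl ∘ predecessors⁻)))

  rank-increasing : ∀ {a b} → R a b → rank a < rank b
  rank-increasing {a} r = subst₂ ℕ._<_ (sym (Finₚ.toℕ-fromℕ< _)) (sym (Finₚ.toℕ-fromℕ< _))
    (Subsetₚ.p⊂q⇒∣p∣<∣q∣ ( predecessors⁺ ∘ (λ c → R-trans c r) ∘ predecessors⁻
                          , a , predecessors⁺ r , irrefl refl ∘ predecessors⁻))

  rank-reflects : ∀ {a b} → rank a < rank b → R a b
  rank-reflects {a} {b} lt with compare a b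
  ... | tri< r _ _ = r
  ... | tri≈ _ refl _ = contradiction lt (Finₚ.<-irrefl refl)
  ... | tri> _ _ r = contradiction (rank-increasing r) (Finₚ.<-asym lt)

  rank-injective : ∀ {a b} → rank a ≡ rank b → a ≡ b
  rank-injective {a} {b} eq with compare a b
  ... | tri< r _ _ = contradiction eq (Finₚ.<⇒≢ (rank-increasing r))
  ... | tri≈ _ a≡b _ = a≡b
  ... | tri> _ _ r = contradiction (sym eq) (Finₚ.<⇒≢ (rank-increasing r))

  unrank : Fin n → Fin n
  unrank i = proj₁ (injective⇒surjective rank-injective i)

  ordering : Perm n
  ordering = permutation unrank rank (λ a → rank-injective (proj₂ (injective⇒surjective rank-injective (rank a))))
                                     (proj₂ ∘ injective⇒surjective rank-injective)

module _ {n} {I : Rel (Fin n) 0ℓ} (I-isInversionSet : IsInversionSet I) where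
  open IsInversionSet I-isInversionSet

  private
    Precedes-trans : ∀ {a b c} → Precedes I a b → Precedes I b c → Precedes I a c
    Precedes-trans (inj₁ (b<a , ab)) (inj₁ (c<b , bc)) = inj₁ (Finₚ.<-trans c<b b<a , transitive ab bc)
    Precedes-trans {a} {c = c} (inj₁ (b<a , ab)) (inj₂ (b<c , ¬cb)) with Finₚ.<-cmp a c
    ... | tri< a<c _ _ = inj₂ (a<c , ¬cb ∘ λ ca → transitive ca ab)
    ... | tri≈ _ refl _ = contradiction ab ¬cb
    ... | tri> _ _ c<a = inj₁ (c<a , [ (λ ac → ac) , (λ cb → contradiction cb ¬cb) ]′ (cotransitive ab b<c c<a))
    Precedes-trans {a} {c = c} (inj₂ (a<b , ¬ba)) (inj₁ (c<b , bc)) with Finₚ.<-cmp a c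
    ... | tri< a<c _ _ = inj₂ (a<c , ¬ba ∘ λ ca → transitive bc ca)
    ... | tri≈ _ refl _ = contradiction bc ¬ba
    ... | tri> _ _ c<a = inj₁ (c<a , [ (λ ba → contradiction ba ¬ba) , (λ ac → ac) ]′ (cotransitive bc c<a a<b))
    Precedes-trans (inj₂ (a<b , ¬ba)) (inj₂ (b<c , ¬cb)) =
      inj₂ (Finₚ.<-trans a<b b<c , [ ¬cb , ¬ba ]′ ∘ λ ca → cotransitive ca a<b b<c)

    Precedes-irrefl : ∀ {a} → ¬ Precedes I a a
    Precedes-irrefl (inj₁ (a<a , _)) = Finₚ.<-irrefl refl a<a
    Precedes-irrefl (inj₂ (a<a , _)) = Finₚ.<-irrefl refl a<a

    Precedes-connex : ∀ {a b} → a ≢ b → Precedes I a b ⊎ Precedes I b a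
    Precedes-connex {a} {b} a≢b with Finₚ.<-cmp a b | dec a b | dec b a
    ... | tri< a<b _ _ | _      | yes ba = inj₂ (inj₁ (a<b , ba))
    ... | tri< a<b _ _ | _      | no ¬ba = inj₁ (inj₂ (a<b , ¬ba))
    ... | tri≈ _ a≡b _ | _      | _      = contradiction a≡b a≢b
    ... | tri> _ _ b<a | yes ab | _      = inj₁ (inj₁ (b<a , ab))
    ... | tri> _ _ b<a | no ¬ab | _      = inj₂ (inj₂ (b<a , ¬ab))

  Precedes-isStrictTotalOrder : IsStrictTotalOrder _≡_ (Precedes I)
  Precedes-isStrictTotalOrder = record
    { isStrictPartialOrder = record
      { isEquivalence = isEquivalence
      ; irrefl        = λ { refl → Precedes-irrefl }
      ; trans         = Precedes-trans
      ; <-resp-≈      = resp₂ (Precedes I)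
      }
    ; compare = trichotomous Precedes-irrefl Precedes-trans Precedes-connex
    }

  -- abstract: only the inversions of realise matter, and unfolding it makes unification blow up
  abstract
    realise : Perm n
    realise = Ordering.ordering Precedes-isStrictTotalOrder

    Inv-realise⁻ : ∀ {a b} → Inv realise a b → I a b
    Inv-realise⁻ ab with Ordering.rank-reflects Precedes-isStrictTotalOrder (Inv⇒Before realise ab)
    ... | inj₁ (_ , ab′) = ab′
    ... | inj₂ (a<b , _) = contradiction (Inv⇒> realise ab) (Finₚ.<-asym a<b)

    Inv-realise⁺ : ∀ {a b} → I a b → Inv realise a b
    Inv-realise⁺ ab = Before⇒Inv realise
      (Ordering.rank-increasing Precedes-isStrictTotalOrder (inj₁ (descending ab , ab))) (descending ab)

-- Joins as transitive closures

record IsInversionBase {n} (B : Rel (Fin n) 0ℓ) : Set where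
  field
    dec          : Decidable B
    descending   : ∀ {a b} → B a b → b < a
    cotransitive : ∀ {a b c} → B a c → c < b → b < a → B a b ⊎ B b c

module _ {n} {B : Rel (Fin n) 0ℓ} where

  closure-least : ∀ {I : Rel (Fin n) 0ℓ} → B ⇒ I → (∀ {a b c} → I a b → I b c → I a c) → TransClosure B ⇒ I
  closure-least B⇒I I-trans [ ab ] = B⇒I ab
  closure-least B⇒I I-trans (ac ∷ cb) = I-trans (B⇒I ac) (closure-least B⇒I I-trans cb)

  closure-isInversionSet : IsInversionBase B → IsInversionSet (TransClosure B)
  closure-isInversionSet B-base = record
    { dec          = λ a b → search (suc (toℕ a)) a b (ℕₚ.n<1+n _)
    ; descending   = descending⁺
    ; transitive   = _++_
    ; cotransitive = cotransitive⁺
    }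
    where
    open IsInversionBase B-base

    descending⁺ : ∀ {a b} → TransClosure B a b → b < a
    descending⁺ [ ab ] = descending ab
    descending⁺ (ac ∷ cb) = Finₚ.<-trans (descending⁺ cb) (descending ac)

    cotransitive⁺ : ∀ {a b c} → TransClosure B a c → c < b → b < a → TransClosure B a b ⊎ TransClosure B b c
    cotransitive⁺ [ ac ] c<b b<a = Sum.map [_] [_] (cotransitive ac c<b b<a)
    cotransitive⁺ {b = b} (_∷_ {y = d} ad dc) c<b b<a with Finₚ.<-cmp b d
    ... | tri< b<d _ _ = Sum.map (ad ∷_) (λ bc → bc) (cotransitive⁺ dc c<b b<d)
    ... | tri≈ _ refl _ = inj₁ [ ad ]
    ... | tri> _ _ d<b = Sum.map [_] (_∷ dc) (cotransitive ad d<b b<a)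

    search : ∀ fuel a b → toℕ a ℕ.< fuel → Dec (TransClosure B a b)
    search (suc fuel) a b a<fuel with dec a b | Finₚ.any? via
      where
      via : ∀ c → Dec (B a c × TransClosure B c b)
      via c with dec a c
      ... | no ¬ac = no (¬ac ∘ proj₁)
      ... | yes ac with search fuel c b (ℕₚ.<-≤-trans (descending ac) (ℕₚ.≤-pred a<fuel))
      ...   | yes cb = yes (ac , cb)
      ...   | no ¬cb = no (¬cb ∘ proj₂)
    ... | yes ab | _ = yes [ ab ]
    ... | no _ | yes (c , ac , cb) = yes (ac ∷ cb)
    ... | no ¬ab | no ¬via = no λ { [ ab ] → ¬ab ab ; (ac ∷ cb) → ¬via (_ , ac , cb) }

Union : ∀ {n} → List (Perm n) → Rel (Fin n) 0ℓ
Union T a b = Any (λ t → Inv t a b) T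

Union-isInversionBase : ∀ {n} (T : List (Perm n)) → IsInversionBase (Union T)
Union-isInversionBase T = record
  { dec          = λ a b → Any.any? (λ t → Inv? t a b) T
  ; descending   = λ ab → let (t , ab′) = Any.satisfied ab in Inv⇒> t ab′
  ; cotransitive = cotransitive
  }
  where
  cotransitive : ∀ {T : List (Perm _)} {a b c} → Union T a c → c < b → b < a → Union T a b ⊎ Union T b c
  cotransitive {t ∷ _} (here ac) c<b b<a = Sum.map here here (IsInversionSet.cotransitive (Inv-isInversionSet t) ac c<b b<a)
  cotransitive (there ac) c<b b<a = Sum.map there there (cotransitive ac c<b b<a)

Union-least : ∀ {n} {T : List (Perm n)} {z : Perm n} → All (_≤w z) T → Union T ⇒ Inv z
Union-least (t≤z ∷ _) (here ab) = t≤z _ _ ab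
Union-least {z = z} (_ ∷ T≤z) (there ab) = Union-least {z = z} T≤z ab

module _ {n} (T : List (Perm n)) where
  private
    closure-isInversionSet⁺ = closure-isInversionSet (Union-isInversionBase T)

  join : Perm n
  join = realise closure-isInversionSet⁺

  join-isJoin : IsJoin T join
  join-isJoin = All.tabulate (λ t∈T a b ab → Inv-realise⁺ closure-isInversionSet⁺ [ Any.map (λ { refl → ab }) t∈T ])
              , λ z T≤z a b ab → closure-least (Union-least {z = z} T≤z) (IsInversionSet.transitive (Inv-isInversionSet z))
                                               (Inv-realise⁻ closure-isInversionSet⁺ ab)

  IsJoin⇒Inv⊆closure : ∀ {x} → IsJoin T x → Inv x ⇒ TransClosure (Union T)
  IsJoin⇒Inv⊆closure (_ , least) ab = Inv-realise⁻ closure-isInversionSet⁺ (least join (proj₁ join-isJoin) _ _ ab)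

  IsJoin⇒closure⊆Inv : ∀ {x} → IsJoin T x → TransClosure (Union T) ⇒ Inv x
  IsJoin⇒closure⊆Inv {x} (T≤x , _) = closure-least (Union-least {z = x} T≤x) (IsInversionSet.transitive (Inv-isInversionSet x))

-- The inversions of the join-irreducible permutation of the arc α.
record ArcInv {n} (α : Arc n) (a b : Fin n) : Set where
  constructor arcInv
  field
    bot≤lower   : bot α ≤ b
    lower<upper : b < a
    upper≤top   : a ≤ top α
    upper-left  : left α a ≡ true
    lower-right : left α b ≡ false

-- Arc leaves the sides of the endpoints unconstrained; arcs of descents put the top on the
-- left and the bottom on the right.
record Normalised {n} (α : Arc n) : Set where
  field
    top-left  : left α (top α) ≡ true
    bot-right : left α (bot α) ≡ false

ArcInv-endpoints : ∀ {n} {α : Arc n} → Normalised α → ArcInv α (top α) (bot α)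
ArcInv-endpoints {α = α} α-normalised =
  arcInv Finₚ.≤-refl (bot<top α) Finₚ.≤-refl (Normalised.top-left α-normalised) (Normalised.bot-right α-normalised)

ArcInv-isInversionSet : ∀ {n} (α : Arc n) → IsInversionSet (ArcInv α)
ArcInv-isInversionSet α = record
  { dec          = λ a b → Dec.map′ (λ (p , q , r , s , t) → arcInv p q r s t) (λ (arcInv p q r s t) → p , q , r , s , t)
                             (bot α ≤? b ×-dec b <? a ×-dec a ≤? top α ×-dec left α a Boolₚ.≟ true ×-dec left α b Boolₚ.≟ false)
  ; descending   = ArcInv.lower<upper
  ; transitive   = λ ab bc → ⊥-elim (≡true⇒≢false (ArcInv.upper-left bc) (ArcInv.lower-right ab))
  ; cotransitive = cotransitive
  }
  where
  cotransitive : ∀ {a b c} → ArcInv α a c → c < b → b < a → ArcInv α a b ⊎ ArcInv α b c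
  cotransitive {b = b} (arcInv bot≤c c<a a≤top a-left c-right) c<b b<a with left α b in eq
  ... | true  = inj₂ (arcInv bot≤c c<b (ℕₚ.<⇒≤ (ℕₚ.<-≤-trans b<a a≤top)) eq c-right)
  ... | false = inj₁ (arcInv (ℕₚ.<⇒≤ (ℕₚ.≤-<-trans bot≤c c<b)) b<a a≤top a-left eq)

Descent-irrelevant : ∀ {n} {x : Perm n} {d} (p q : Descent x d) → p ≡ q
Descent-irrelevant (j , j≡ , lt) (j′ , j′≡ , lt′) with Finₚ.toℕ-injective (trans j≡ (sym j′≡))
... | refl = cong₂ (λ e l → j , e , l) (ℕₚ.≡-irrelevant j≡ j′≡) (Finₚ.<-irrelevant lt lt′)

-- The arc of the descent at position d; for a join-irreducible x, arcOf x is definitionally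
-- the arc of its descent.
descentArc : ∀ {n} (x : Perm n) {d} → Descent x d → Arc n
descentArc x {d} (j , _ , lt) = record
  { bot = x ⟨$⟩ʳ j ; top = x ⟨$⟩ʳ d ; bot<top = lt ; left = λ c → ⌊ x ⟨$⟩ˡ c ≤? d ⌋ }

module DescentArc {n} (x : Perm n) {d} (desc : Descent x d) where
  α : Arc n
  α = descentArc x desc

  position-top : x ⟨$⟩ˡ top α ≡ d
  position-top = inverseˡ x

  position-bot : toℕ (x ⟨$⟩ˡ bot α) ≡ suc (toℕ d)
  position-bot = trans (cong toℕ (inverseˡ x)) (proj₁ (proj₂ desc))

  left⁻ : ∀ {c} → left α c ≡ true → x ⟨$⟩ˡ c ≤ d
  left⁻ = ⌊⌋-true⁻ (x ⟨$⟩ˡ _ ≤? d)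

  right⁻ : ∀ {c} → left α c ≡ false → d < x ⟨$⟩ˡ c
  right⁻ c-right = ℕₚ.≰⇒> (⌊⌋-false⁻ (x ⟨$⟩ˡ _ ≤? d) c-right)

  left⁺ : ∀ {c} → x ⟨$⟩ˡ c ≤ d → left α c ≡ true
  left⁺ = ⌊⌋-true⁺ (x ⟨$⟩ˡ _ ≤? d)

  right⁺ : ∀ {c} → d < x ⟨$⟩ˡ c → left α c ≡ false
  right⁺ d<c = ⌊⌋-false⁺ (x ⟨$⟩ˡ _ ≤? d) (ℕₚ.<⇒≱ d<c)

  normalised : Normalised α
  normalised = record
    { top-left  = left⁺ (Finₚ.≤-reflexive position-top)
    ; bot-right = right⁺ (subst (toℕ d ℕ.<_) (sym position-bot) (ℕₚ.n<1+n _)) }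

  adjacent : ∀ {c} → Before x (top α) c → ¬ Before x c (bot α)
  adjacent {c} top<c c<bot = ℕₚ.<⇒≱ (subst (λ p → p < x ⟨$⟩ˡ c) position-top top<c)
                                     (ℕₚ.≤-pred (subst (toℕ (x ⟨$⟩ˡ c) ℕ.<_) position-bot c<bot))

  ArcInv⇒Inv : ArcInv α ⇒ Inv x
  ArcInv⇒Inv (arcInv _ b<a _ a-left b-right) = Before⇒Inv x (ℕₚ.≤-<-trans (left⁻ a-left) (right⁻ b-right)) b<a

descentArc-unique : ∀ {n} (x : Perm n) {d d′} (desc : Descent x d) (desc′ : Descent x d′) →
  ArcInv (descentArc x desc′) (top (descentArc x desc)) (bot (descentArc x desc)) → d′ ≡ d
descentArc-unique x desc desc′ (arcInv _ _ _ top-left bot-right) = Finₚ.toℕ-injective (ℕₚ.≤-antisym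
  (ℕₚ.≤-pred (subst (toℕ _ ℕ.<_) (DescentArc.position-bot x desc) (DescentArc.right⁻ x desc′ bot-right)))
  (subst (_≤ _) (DescentArc.position-top x desc) (DescentArc.left⁻ x desc′ top-left)))

-- Descents generate the inversions

module _ {n} (x : Perm n) {I : Rel (Fin n) 0ℓ} (I-trans : ∀ {a b c} → I a b → I b c → I a c)
         (descents⊆I : ∀ {d} (desc : Descent x d) → ArcInv (descentArc x desc) ⇒ I) where
  private
    X : Fin n → Fin n
    X = x ⟨$⟩ʳ_

    Gapless : Fin n → Fin n → Set
    Gapless k l = ∀ m → k < m → m < l → X l < X m → ¬ X m < X k

    next : ∀ {c l : Fin n} → c < l → Fin n
    next {l = l} c<l = fromℕ< (ℕₚ.<-≤-trans (s≤s c<l) (Finₚ.toℕ<n l))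

    -- the last position c ∈ [k , l) with X k ≤ X c is a descent whose arc contains (X k , X l)
    scan : ∀ {k l} → Gapless k l → X l < X k → ∀ {c} → Acc _>_ c → k ≤ c → (c<l : c < l) → X k ≤ X c →
           Σ[ d ∈ Fin n ] Σ[ desc ∈ Descent x d ] ArcInv (descentArc x desc) (X k) (X l)
    scan {k} {l} gapless l<k {c} (acc later) k≤c c<l k≤c-value = step
      where
      c′ : Fin n
      c′ = next c<l
      toℕ-c′ : toℕ c′ ≡ suc (toℕ c)
      toℕ-c′ = Finₚ.toℕ-fromℕ< _
      c<c′ : c < c′
      c<c′ = subst (toℕ c ℕ.<_) (sym toℕ-c′) (ℕₚ.n<1+n _)
      c′≤l : c′ ≤ l
      c′≤l = subst (ℕ._≤ toℕ l) (sym toℕ-c′) c<l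

      step : Σ[ d ∈ Fin n ] Σ[ desc ∈ Descent x d ] ArcInv (descentArc x desc) (X k) (X l)
      step with Finₚ.<-cmp (X c′) (X k)
      ... | tri< c′<k _ _ = c , desc , arcInv bot≤l l<k k≤c-value (left⁺ (subst (_≤ c) (sym (inverseˡ x)) k≤c))
                                                             (right⁺ (subst (c <_) (sym (inverseˡ x)) c<l))
        where
        desc : Descent x c
        desc = c′ , toℕ-c′ , ℕₚ.<-≤-trans c′<k k≤c-value
        open DescentArc x desc using (left⁺; right⁺)
        bot≤l : X c′ ≤ X l
        bot≤l with X l <? X c′
        ... | no l≮c′ = ℕₚ.≮⇒≥ l≮c′
        ... | yes l<c′ = ⊥-elim (gapless c′ (ℕₚ.≤-<-trans k≤c c<c′)
                                   (Finₚ.≤∧≢⇒< c′≤l (λ c′≡l → Finₚ.<-irrefl (cong X (sym c′≡l)) l<c′)) l<c′ c′<k)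
      ... | tri≈ _ c′≡k _ = contradiction (⟨$⟩ʳ-injective x c′≡k) (Finₚ.<⇒≢ (ℕₚ.≤-<-trans k≤c c<c′) ∘ sym)
      ... | tri> _ _ k<c′ = scan gapless l<k (later c<c′) (ℕₚ.<⇒≤ (ℕₚ.≤-<-trans k≤c c<c′))
                              (Finₚ.≤∧≢⇒< c′≤l (λ c′≡l → Finₚ.<-asym l<k (subst (λ m → X k < X m) c′≡l k<c′)))
                              (ℕₚ.<⇒≤ k<c′)

    by-span : ∀ {k l} → Acc ℕ._<_ (toℕ l ∸ toℕ k) → k < l → X l < X k → I (X k) (X l)
    by-span {k} {l} (acc shorter) k<l l<k with Finₚ.any? (λ m → k <? m ×-dec m <? l ×-dec X l <? X m ×-dec X m <? X k)
    ... | yes (m , k<m , m<l , l<m , m<k) =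
      I-trans (by-span (shorter (ℕₚ.∸-monoˡ-< m<l (ℕₚ.<⇒≤ k<m))) k<m m<k)
              (by-span (shorter (ℕₚ.∸-monoʳ-< k<m (ℕₚ.<⇒≤ m<l))) m<l l<m)
    ... | no no-gap =
      let (d , desc , kl) = scan gapless l<k (>-wellFounded k) Finₚ.≤-refl k<l Finₚ.≤-refl
      in descents⊆I desc kl
      where
      gapless : Gapless k l
      gapless m k<m m<l l<m m<k = no-gap (m , k<m , m<l , l<m , m<k)

  descents-generate-Inv : Inv x ⇒ I
  descents-generate-Inv (i , j , i<j , refl , refl , b<a) = by-span (ℕ-<-wellFounded _) i<j b<a

ArcInv-descentArc-irrelevant : ∀ {n} (x : Perm n) {d d′} → d ≡ d′ → (p : Descent x d) (q : Descent x d′) →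
  ArcInv (descentArc x p) ⇒ ArcInv (descentArc x q)
ArcInv-descentArc-irrelevant x refl p q {a} {b} = subst (λ r → ArcInv (descentArc x r) a b) (Descent-irrelevant {x = x} p q)

module _ {n} (x : Perm n) (x-ji : JoinIrreducible x) where
  private
    desc = proj₁ (proj₂ x-ji)

  arcOf-normalised : Normalised (arcOf x x-ji)
  arcOf-normalised = DescentArc.normalised x desc

  ArcInv-arcOf⇒Inv : ArcInv (arcOf x x-ji) ⇒ Inv x
  ArcInv-arcOf⇒Inv = DescentArc.ArcInv⇒Inv x desc

  Inv⇒ArcInv-arcOf : Inv x ⇒ ArcInv (arcOf x x-ji)
  Inv⇒ArcInv-arcOf = descents-generate-Inv x (IsInversionSet.transitive (ArcInv-isInversionSet (arcOf x x-ji))) only-descent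
    where
    only-descent : ∀ {d} (desc′ : Descent x d) → ArcInv (descentArc x desc′) ⇒ ArcInv (arcOf x x-ji)
    only-descent {d} desc′ with proj₂ (proj₂ x-ji) d desc′
    ... | refl = ArcInv-descentArc-irrelevant x refl desc′ desc

Descent? : ∀ {n} (x : Perm n) d → Dec (Descent x d)
Descent? x d = Finₚ.any? (λ j → toℕ j ℕₚ.≟ suc (toℕ d) ×-dec x ⟨$⟩ʳ j <? x ⟨$⟩ʳ d)

-- The inversions of the join-irreducible of a position d: empty unless d is a descent.
DescentInv : ∀ {n} → Perm n → Fin n → Rel (Fin n) 0ℓ
DescentInv x d a b = Σ[ desc ∈ Descent x d ] ArcInv (descentArc x desc) a b

DescentInv-isInversionSet : ∀ {n} (x : Perm n) d → IsInversionSet (DescentInv x d)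
DescentInv-isInversionSet x d = record
  { dec          = dec
  ; descending   = λ (desc , ab) → ArcInvOf.descending desc ab
  ; transitive   = λ (p , ab) (q , bc) → p , ArcInvOf.transitive p ab (ArcInv-descentArc-irrelevant x refl q p bc)
  ; cotransitive = λ (p , ac) c<b b<a → Sum.map (p ,_) (p ,_) (ArcInvOf.cotransitive p ac c<b b<a)
  }
  where
  module ArcInvOf (desc : Descent x d) = IsInversionSet (ArcInv-isInversionSet (descentArc x desc))

  dec : Decidable (DescentInv x d)
  dec a b with Descent? x d
  ... | no ¬desc = no (¬desc ∘ proj₁)
  ... | yes desc = Dec.map′ (desc ,_) (λ (p , ab) → ArcInv-descentArc-irrelevant x refl p desc ab) (ArcInvOf.dec desc a b)

descentJI : ∀ {n} → Perm n → Fin n → Perm n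
descentJI x d = realise (DescentInv-isInversionSet x d)

descentJIs-isJoin : ∀ {n} (x : Perm n) → IsJoin (tabulate (descentJI x)) x
descentJIs-isJoin x =
    Allₚ.tabulate⁺ (λ d a b ab → let (desc , ab′) = Inv-realise⁻ (DescentInv-isInversionSet x d) ab
                                  in DescentArc.ArcInv⇒Inv x desc ab′)
  , λ z above a b → descents-generate-Inv x (IsInversionSet.transitive (Inv-isInversionSet z))
                      (λ {d} desc ab → Allₚ.tabulate⁻ above d _ _ (Inv-realise⁺ (DescentInv-isInversionSet x d) (desc , ab)))

module _ {n} (x : Perm n) {d} (desc : Descent x d) where
  open DescentArc x desc

  inverts-descent⇒ArcInv⊆Inv : ∀ {t} → t ≤w x → Inv t (top α) (bot α) → ArcInv α ⇒ Inv t
  inverts-descent⇒ArcInv⊆Inv {t} t≤x top-bot {a} {b} (arcInv bot≤b b<a a≤top a-left b-right) = a-b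
    where
    open IsInversionSet (Inv-isInversionSet t) using (cotransitive)
    a-bot : Inv t a (bot α)
    a-bot with a ≟ top α
    ... | yes refl = top-bot
    ... | no a≢top = [ (λ top-a → contradiction (left⁻ a-left)
                                     (ℕₚ.<⇒≱ (subst (_< _) position-top (Inv⇒Before x (t≤x _ _ top-a)))))
                     , (λ a-bot → a-bot) ]′
                     (cotransitive top-bot (ℕₚ.≤-<-trans bot≤b b<a) (Finₚ.≤∧≢⇒< a≤top a≢top))
    a-b : Inv t a b
    a-b with b ≟ bot α
    ... | yes refl = a-bot
    ... | no b≢bot = [ (λ a-b → a-b)
                     , (λ b-bot → contradiction (right⁻ b-right)
                                     (ℕₚ.≤⇒≯ (ℕₚ.≤-pred (subst (_ ℕ.<_) position-bot (Inv⇒Before x (t≤x _ _ b-bot)))))) ]′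
                     (cotransitive a-bot (Finₚ.≤∧≢⇒< bot≤b (b≢bot ∘ sym)) b<a)

  -- a chain of two or more inversions from top α to bot α would pass a value lying between them in x
  IsJoin⇒inverts-descent : ∀ {T} → IsJoin T x → Any (λ t → Inv t (top α) (bot α) × t ≤w x) T
  IsJoin⇒inverts-descent {T} T-join = single-step (IsJoin⇒Inv⊆closure T {x} T-join (ArcInv⇒Inv (ArcInv-endpoints normalised)))
    where
    single-step : TransClosure (Union T) (top α) (bot α) → Any (λ t → Inv t (top α) (bot α) × t ≤w x) T
    single-step [ top-bot ] = Any-×-All top-bot (proj₁ T-join)
    single-step (top-c ∷ c-bot) = ⊥-elim (adjacent (Inv⇒Before x (IsJoin⇒closure⊆Inv T {x} T-join [ top-c ]))
                                                   (Inv⇒Before x (IsJoin⇒closure⊆Inv T {x} T-join c-bot)))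

-- Canonical join representations

record DescentEnumeration {n m} (x : Perm n) (I : Fin m → Rel (Fin n) 0ℓ) : Set where
  field
    position            : Fin m → Fin n
    descent             : ∀ e → Descent x (position e)
    ⊆ArcInv             : ∀ e → I e ⇒ ArcInv (descentArc x (descent e))
    ArcInv⊆             : ∀ e → ArcInv (descentArc x (descent e)) ⇒ I e
    position-injective  : ∀ {e f} → position e ≡ position f → e ≡ f
    position-surjective : ∀ {d} → Descent x d → ∃ λ e → position e ≡ d

module _ {n} {x : Perm n} {J : List (Perm n)} (enum : DescentEnumeration x (λ e → Inv (lookup J e))) where
  open DescentEnumeration enum

  private
    α : Fin (length J) → Arc n
    α e = descentArc x (descent e)

    least : ∀ z → All (_≤w z) J → x ≤w z
    least z J≤z _ _ = descents-generate-Inv x (IsInversionSet.transitive (Inv-isInversionSet z)) descent⊆z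
      where
      descent⊆z : ∀ {d} (desc : Descent x d) → ArcInv (descentArc x desc) ⇒ Inv z
      descent⊆z desc ab with position-surjective desc
      ... | e , refl = All-lookup J≤z e _ _ (ArcInv⊆ e (ArcInv-descentArc-irrelevant x refl desc (descent e) ab))

    isJoin : IsJoin J x
    isJoin = All-tabulate (λ e _ _ ab → DescentArc.ArcInv⇒Inv x (descent e) (⊆ArcInv e ab)) , least

    below-joinands : ∀ T → IsJoin T x → All (λ j → Any (j ≤w_) T) J
    below-joinands T T-join = All-tabulate λ e →
      Any.map (λ {t} (top-bot , t≤x) _ _ ab → inverts-descent⇒ArcInv⊆Inv x (descent e) {t} t≤x top-bot (⊆ArcInv e ab))
              (IsJoin⇒inverts-descent x (descent e) T-join)

    irredundant : Irredundant J x
    irredundant T T⊆J T-join = All-tabulate λ e →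
      Any.map (λ {t} (e≤t , t∈J) → equal e {t} e≤t t∈J) (Any-×-All (All-lookup (below-joinands T T-join) e) T⊆J)
      where
      equal : ∀ e {t} → lookup J e ≤w t → t ∈ₚ J → lookup J e ≈ₚ t
      equal e {t} e≤t t∈J = ≈ₚ-sym {x = t} {y = lookup J e} (subst (λ g → t ≈ₚ lookup J g) f≡e t≈f)
        where
        f = Any.index t∈J
        t≈f : t ≈ₚ lookup J f
        t≈f = Anyₚ.lookup-index t∈J
        f-inverts-e : Inv (lookup J f) (top (α e)) (bot (α e))
        f-inverts-e = Inv-resp-≈ₚ {x = t} {y = lookup J f} t≈f
                        (e≤t _ _ (ArcInv⊆ e (ArcInv-endpoints (DescentArc.normalised x (descent e)))))
        f≡e : f ≡ e
        f≡e = position-injective (descentArc-unique x (descent e) (descent f) (⊆ArcInv f f-inverts-e))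

  enumeration⇒canonical : IsCanonicalJoinRep J x
  enumeration⇒canonical = isJoin , irredundant , below-joinands

module _ {n} {x : Perm n} {J : List (Perm n)} (J-ji : All JoinIrreducible J) (J-distinct : Distinct J)
         (J-canonical : IsCanonicalJoinRep J x) where
  private
    J-join = proj₁ J-canonical
    J-irredundant = proj₁ (proj₂ J-canonical)
    J-below = proj₂ (proj₂ J-canonical)

    -- dropping J e and its copies from J would leave a list with the same join
    antichain : ∀ {e f} → e ≢ f → ¬ lookup J e ≤w lookup J f
    antichain {e} {f} e≢f e≤f = All.lookupWith (λ {t} t≉u u≈t → t≉u (≈ₚ-sym {x = u} {y = t} u≈t)) (Allₚ.all-filter others J)
                                  (All-lookup (J-irredundant T T⊆J T-join) e)
      where
      u = lookup J e
      others = λ t → ¬? (t ≈ₚ? u)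
      T = filter others J

      T⊆J : T ⊆ₚ J
      T⊆J = All.tabulate (λ t∈T → Any.map (λ { refl _ → refl }) (proj₁ (∈-filter⁻ others t∈T)))

      f≉u : ¬ lookup J f ≈ₚ u
      f≉u f≈u = Distinct-lookup J-distinct e≢f (≈ₚ-sym {x = lookup J f} {y = u} f≈u)

      T-join : IsJoin T x
      T-join = All.tabulate (λ t∈T → All.lookup (proj₁ J-join) (proj₁ (∈-filter⁻ others t∈T)))
             , λ z T≤z → proj₂ J-join z (All.tabulate (J≤z z T≤z))
        where
        J≤z : ∀ z → All (_≤w z) T → ∀ {t} → Any (t ≡_) J → t ≤w z
        J≤z z T≤z {t} t∈J with t ≈ₚ? u
        ... | no t≉u = All.lookup T≤z (∈-filter⁺ others t∈J t≉u)
        ... | yes t≈u = λ a b → f≤z a b ∘ e≤f a b ∘ Inv-resp-≈ₚ {x = t} {y = u} t≈u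
          where f≤z = All.lookup T≤z (∈-filter⁺ others (∈-lookup {xs = J} f) f≉u)

    record DescentOf (e : Fin (length J)) : Set where
      field
        position : Fin n
        descent  : Descent x position
        ⊆ArcInv  : Inv (lookup J e) ⇒ ArcInv (descentArc x descent)
        ArcInv⊆  : ArcInv (descentArc x descent) ⇒ Inv (lookup J e)

    -- J e lies below the join-irreducible of some descent, which lies below some J f; by
    -- the antichain property f = e, so J e is that join-irreducible.
    descentOf : ∀ e → DescentOf e
    descentOf e = record { position = d ; descent = desc ; ⊆ArcInv = e⊆desc ; ArcInv⊆ = desc⊆e }
      where
      u = lookup J e
      u-ji : JoinIrreducible u
      u-ji = All-lookup J-ji e

      below-descentJI : ∃ λ d → u ≤w descentJI x d
      below-descentJI = Anyₚ.tabulate⁻ (All-lookup (J-below (tabulate (descentJI x)) (descentJIs-isJoin x)) e)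
      d = proj₁ below-descentJI
      e≤d = proj₂ below-descentJI

      e⊆d : Inv u ⇒ DescentInv x d
      e⊆d ab = Inv-realise⁻ (DescentInv-isInversionSet x d) (e≤d _ _ ab)

      desc : Descent x d
      desc = proj₁ (e⊆d (ArcInv-arcOf⇒Inv u u-ji (ArcInv-endpoints (arcOf-normalised u u-ji))))

      e⊆desc : Inv u ⇒ ArcInv (descentArc x desc)
      e⊆desc ab = let (p , ab′) = e⊆d ab in ArcInv-descentArc-irrelevant x refl p desc ab′

      inverting : Any (λ t → Inv t (top (descentArc x desc)) (bot (descentArc x desc)) × t ≤w x) J
      inverting = IsJoin⇒inverts-descent x desc J-join
      f = Any.index inverting

      desc⊆f : ArcInv (descentArc x desc) ⇒ Inv (lookup J f)
      desc⊆f = inverts-descent⇒ArcInv⊆Inv x desc {lookup J f} (proj₂ (Anyₚ.lookup-index inverting))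
                                                               (proj₁ (Anyₚ.lookup-index inverting))

      desc⊆e : ArcInv (descentArc x desc) ⇒ Inv u
      desc⊆e = by (e ≟ f)
        where
        by : Dec (e ≡ f) → ArcInv (descentArc x desc) ⇒ Inv u
        by (yes e≡f) = subst (λ g → ArcInv (descentArc x desc) ⇒ Inv (lookup J g)) (sym e≡f) desc⊆f
        by (no e≢f) = contradiction (λ a b ab → desc⊆f (e⊆desc ab)) (antichain e≢f)

  canonical⇒enumeration : DescentEnumeration x (λ e → Inv (lookup J e))
  canonical⇒enumeration = record
    { position            = DescentOf.position ∘ descentOf
    ; descent             = DescentOf.descent ∘ descentOf
    ; ⊆ArcInv             = DescentOf.⊆ArcInv ∘ descentOf
    ; ArcInv⊆             = DescentOf.ArcInv⊆ ∘ descentOf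
    ; position-injective  = injective
    ; position-surjective = surjective
    }
    where
    open DescentOf

    injective : ∀ {e f} → position (descentOf e) ≡ position (descentOf f) → e ≡ f
    injective {e} {f} same = decidable-stable (e ≟ f) λ e≢f → Distinct-lookup J-distinct e≢f
      (Inv-injective (lookup J e) (lookup J f) (λ _ _ → shared⊆ e f same ∘ ⊆ArcInv (descentOf e))
                                               (λ _ _ → shared⊆ f e (sym same) ∘ ⊆ArcInv (descentOf f)))
      where
      shared⊆ : ∀ e f → position (descentOf e) ≡ position (descentOf f) →
                ArcInv (descentArc x (descent (descentOf e))) ⇒ Inv (lookup J f)
      shared⊆ e f same = ArcInv⊆ (descentOf f) ∘ ArcInv-descentArc-irrelevant x same (descent (descentOf e)) (descent (descentOf f))

    surjective : ∀ {d} → Descent x d → ∃ λ e → position (descentOf e) ≡ d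
    surjective desc = f , descentArc-unique x desc (descent (descentOf f))
                            (⊆ArcInv (descentOf f) (proj₁ (Anyₚ.lookup-index inverting)))
      where
      inverting = IsJoin⇒inverts-descent x desc J-join
      f = Any.index inverting

InRange : ∀ {n} → Arc n → Fin n → Set
InRange α c = bot α ≤ c × c ≤ top α

-- 0: strictly left of α, 1: an endpoint of α, 2: strictly right of α
side : ∀ {n} → Arc n → Fin n → ℕ
side α c with c ≟ bot α | c ≟ top α
... | yes _ | _     = 1
... | no _  | yes _ = 1
... | no _  | no _  = if left α c then 0 else 2

module _ {n} (α : Arc n) where

  side-bot : side α (bot α) ≡ 1
  side-bot with bot α ≟ bot α
  ... | yes _ = refl
  ... | no bot≢bot = contradiction refl bot≢bot

  side-top : side α (top α) ≡ 1
  side-top with top α ≟ bot α | top α ≟ top α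
  ... | yes _ | _ = refl
  ... | no _ | yes _ = refl
  ... | no _ | no top≢top = contradiction refl top≢top

  side-interior : ∀ {c} → c ≢ bot α → c ≢ top α → side α c ≡ (if left α c then 0 else 2)
  side-interior {c} c≢bot c≢top with c ≟ bot α | c ≟ top α
  ... | yes c≡bot | _ = contradiction c≡bot c≢bot
  ... | no _ | yes c≡top = contradiction c≡top c≢top
  ... | no _ | no _ = refl

  side-left : ∀ {c} → c ≢ bot α → c ≢ top α → left α c ≡ true → side α c ≡ 0
  side-left c≢bot c≢top c-left = trans (side-interior c≢bot c≢top) (cong (if_then 0 else 2) c-left)

  side-right : ∀ {c} → c ≢ bot α → c ≢ top α → left α c ≡ false → side α c ≡ 2
  side-right c≢bot c≢top c-right = trans (side-interior c≢bot c≢top) (cong (if_then 0 else 2) c-right)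

  side-lower : ∀ {a b} → ArcInv α a b → 1 ℕ.≤ side α b
  side-lower {b = b} (arcInv _ b<a a≤top _ b-right) = case b ≟ bot α of λ where
    (yes refl) → ℕₚ.≤-reflexive (sym side-bot)
    (no b≢bot) → ℕₚ.≤-trans (s≤s z≤n)
                   (ℕₚ.≤-reflexive (sym (side-right b≢bot (Finₚ.<⇒≢ (ℕₚ.<-≤-trans b<a a≤top)) b-right)))

  side-upper : ∀ {a b} → ArcInv α a b → side α a ℕ.≤ 1
  side-upper {a} (arcInv bot≤b b<a _ a-left _) = case a ≟ top α of λ where
    (yes refl) → ℕₚ.≤-reflexive side-top
    (no a≢top) → ℕₚ.≤-trans (ℕₚ.≤-reflexive (side-left (Finₚ.<⇒≢ (ℕₚ.≤-<-trans bot≤b b<a) ∘ sym) a≢top a-left)) z≤n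

record Uncrossed {n} (α β : Arc n) : Set where
  field
    tops-differ : top α ≢ top β
    bots-differ : bot α ≢ bot β
    no-crossing : ∀ {c c′} → InRange α c → InRange β c → InRange α c′ → InRange β c′ →
                  side α c ℕ.< side β c → ¬ side β c′ ℕ.< side α c′

Uncrossed-sym : ∀ {n} {α β : Arc n} → Uncrossed α β → Uncrossed β α
Uncrossed-sym α-β = record
  { tops-differ = tops-differ ∘ sym
  ; bots-differ = bots-differ ∘ sym
  ; no-crossing = λ βc αc βc′ αc′ β<α α<β → no-crossing αc′ βc′ αc βc α<β β<α
  }
  where open Uncrossed α-β

-- Otherwise β would pass right of α at b and left of α at a.
ArcInv-uncrossed : ∀ {n} {α β : Arc n} → Normalised α → Uncrossed α β → ∀ {a b} → ArcInv β a b →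
  bot α ≤ b → a ≤ top α → b ≡ bot α ⊎ left α b ≡ true → a ≡ top α ⊎ left α a ≡ false → ⊥
ArcInv-uncrossed {α = α} {β} α-normalised α-β {a} {b} ab@(arcInv bot≤b b<a a≤top _ _) bot≤b′ a≤top′ b-side a-side =
  no-crossing (bot≤b′ , ℕₚ.<⇒≤ (ℕₚ.<-≤-trans b<a a≤top′)) (bot≤b , ℕₚ.<⇒≤ (ℕₚ.<-≤-trans b<a a≤top))
              (ℕₚ.<⇒≤ (ℕₚ.≤-<-trans bot≤b′ b<a) , a≤top′) (ℕₚ.<⇒≤ (ℕₚ.≤-<-trans bot≤b b<a) , a≤top)
              α<β-at-b β<α-at-a
  where
  open Uncrossed α-β
  open Normalised α-normalised

  b<topβ : b < top β
  b<topβ = ℕₚ.<-≤-trans b<a a≤top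

  botβ<a : bot β < a
  botβ<a = ℕₚ.≤-<-trans bot≤b b<a

  α<β-at-b : side α b ℕ.< side β b
  α<β-at-b = [ if-bot , if-left ]′ b-side
    where
    if-bot : b ≡ bot α → side α b ℕ.< side β b
    if-bot b≡bot = subst₂ ℕ._<_ (sym (trans (cong (side α) b≡bot) (side-bot α)))
      (sym (side-right β (λ b≡botβ → bots-differ (trans (sym b≡bot) b≡botβ)) (Finₚ.<⇒≢ b<topβ) (ArcInv.lower-right ab)))
      ℕₚ.≤-refl

    if-left : left α b ≡ true → side α b ℕ.< side β b
    if-left b-left = subst (ℕ._< side β b)
      (sym (side-left α (λ b≡bot → ≡true⇒≢false b-left (trans (cong (left α) b≡bot) bot-right))
                        (Finₚ.<⇒≢ (ℕₚ.<-≤-trans b<a a≤top′)) b-left))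
      (side-lower β ab)

  β<α-at-a : side β a ℕ.< side α a
  β<α-at-a = [ if-top , if-right ]′ a-side
    where
    if-top : a ≡ top α → side β a ℕ.< side α a
    if-top a≡top = subst₂ ℕ._<_
      (sym (side-left β (Finₚ.<⇒≢ botβ<a ∘ sym) (λ a≡topβ → tops-differ (trans (sym a≡top) a≡topβ)) (ArcInv.upper-left ab)))
      (sym (trans (cong (side α) a≡top) (side-top α)))
      ℕₚ.≤-refl

    if-right : left α a ≡ false → side β a ℕ.< side α a
    if-right a-right = subst (side β a ℕ.<_)
      (sym (side-right α (Finₚ.<⇒≢ (ℕₚ.≤-<-trans bot≤b′ b<a) ∘ sym)
                         (λ a≡top → ≡true⇒≢false (trans (cong (left α) a≡top) top-left) a-right) a-right))
      (s≤s (side-upper β ab))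

module _ {n} {α β : Arc n} (α≈β : α ≈ₐ β) where
  private
    bot≡ = proj₁ α≈β
    top≡ = proj₁ (proj₂ α≈β)
    left≡ = proj₂ (proj₂ α≈β)

  ≈ₐ-sym : β ≈ₐ α
  ≈ₐ-sym = sym bot≡ , sym top≡ ,
           λ c (bot<c , c<top) → sym (left≡ c (subst (_< c) (sym bot≡) bot<c , subst (c <_) (sym top≡) c<top))

  InRange-resp-≈ₐ : ∀ {c} → InRange α c → InRange β c
  InRange-resp-≈ₐ (bot≤c , c≤top) = subst (_≤ _) bot≡ bot≤c , subst (_ ≤_) top≡ c≤top

  side-resp-≈ₐ : ∀ {c} → InRange α c → side α c ≡ side β c
  side-resp-≈ₐ {c} (bot≤c , c≤top) with c ≟ bot α | c ≟ top α | c ≟ bot β | c ≟ top β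
  ... | yes _ | _     | yes _ | _     = refl
  ... | yes _ | _     | no _  | yes _ = refl
  ... | yes c≡bot | _ | no c≢bot | no _ = contradiction (trans c≡bot bot≡) c≢bot
  ... | no _  | yes _ | yes _ | _     = refl
  ... | no _  | yes _ | no _  | yes _ = refl
  ... | no _  | yes c≡top | no _ | no c≢top = contradiction (trans c≡top top≡) c≢top
  ... | no c≢bot | no _ | yes c≡bot | _ = contradiction (trans c≡bot (sym bot≡)) c≢bot
  ... | no _ | no c≢top | no _ | yes c≡top = contradiction (trans c≡top (sym top≡)) c≢top
  ... | no c≢bot | no c≢top | no _ | no _ =
    cong (if_then 0 else 2) (left≡ c (Finₚ.≤∧≢⇒< bot≤c (c≢bot ∘ sym) , Finₚ.≤∧≢⇒< c≤top c≢top))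

  ArcInv-resp-≈ₐ : Normalised α → Normalised β → ArcInv α ⇒ ArcInv β
  ArcInv-resp-≈ₐ α-normalised β-normalised {a} {b} (arcInv bot≤b b<a a≤top a-left b-right) =
    arcInv (subst (_≤ b) bot≡ bot≤b) b<a (subst (a ≤_) top≡ a≤top) a-left′ b-right′
    where
    a-left′ : left β a ≡ true
    a-left′ = case a ≟ top α of λ where
      (yes refl) → subst (λ t → left β t ≡ true) (sym top≡) (Normalised.top-left β-normalised)
      (no a≢top) → trans (sym (left≡ a (ℕₚ.≤-<-trans bot≤b b<a , Finₚ.≤∧≢⇒< a≤top a≢top))) a-left
    b-right′ : left β b ≡ false
    b-right′ = case b ≟ bot α of λ where
      (yes refl) → subst (λ t → left β t ≡ false) (sym bot≡) (Normalised.bot-right β-normalised)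
      (no b≢bot) → trans (sym (left≡ b (Finₚ.≤∧≢⇒< bot≤b (b≢bot ∘ sym) , ℕₚ.<-≤-trans b<a a≤top))) b-right

≈ₐ-trans : ∀ {n} {α β γ : Arc n} → α ≈ₐ β → β ≈ₐ γ → α ≈ₐ γ
≈ₐ-trans (bot≡ , top≡ , left≡) (bot≡′ , top≡′ , left≡′) =
  trans bot≡ bot≡′ , trans top≡ top≡′ ,
  λ c (bot<c , c<top) → trans (left≡ c (bot<c , c<top)) (left≡′ c (subst (_< c) bot≡ bot<c , subst (c <_) top≡ c<top))

Uncrossed-resp-≈ₐ : ∀ {n} {α α′ β β′ : Arc n} → α ≈ₐ α′ → β ≈ₐ β′ → Uncrossed α β → Uncrossed α′ β′
Uncrossed-resp-≈ₐ {α = α} {α′} {β} {β′} α≈α′ β≈β′ α-β = record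
  { tops-differ = λ eq → tops-differ (trans (proj₁ (proj₂ α≈α′)) (trans eq (sym (proj₁ (proj₂ β≈β′)))))
  ; bots-differ = λ eq → bots-differ (trans (proj₁ α≈α′) (trans eq (sym (proj₁ β≈β′))))
  ; no-crossing = λ α′c β′c α′c′ β′c′ α′<β′ β′<α′ →
      no-crossing (α′⊆α α′c) (β′⊆β β′c) (α′⊆α α′c′) (β′⊆β β′c′)
        (subst₂ ℕ._<_ (side-α′≡α α′c) (side-β′≡β β′c) α′<β′)
        (subst₂ ℕ._<_ (side-β′≡β β′c′) (side-α′≡α α′c′) β′<α′)
  }
  where
  open Uncrossed α-β
  α′≈α : α′ ≈ₐ α
  α′≈α = ≈ₐ-sym {α = α} {α′} α≈α′
  β′≈β : β′ ≈ₐ β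
  β′≈β = ≈ₐ-sym {α = β} {β′} β≈β′
  α′⊆α : ∀ {c} → InRange α′ c → InRange α c
  α′⊆α = InRange-resp-≈ₐ {α = α′} {α} α′≈α
  β′⊆β : ∀ {c} → InRange β′ c → InRange β c
  β′⊆β = InRange-resp-≈ₐ {α = β′} {β} β′≈β
  side-α′≡α : ∀ {c} → InRange α′ c → side α′ c ≡ side α c
  side-α′≡α = side-resp-≈ₐ {α = α′} {α} α′≈α
  side-β′≡β : ∀ {c} → InRange β′ c → side β′ c ≡ side β c
  side-β′≡β = side-resp-≈ₐ {α = β′} {β} β′≈β

ArcInv-≈ₐ : ∀ {n} {α β : Arc n} → Normalised α → Normalised β → ArcInv α ⇒ ArcInv β → ArcInv β ⇒ ArcInv α → α ≈ₐ β
ArcInv-≈ₐ {α = α} {β} α-normalised β-normalised α⊆β β⊆α = bot≡ , top≡ , left≡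
  where
  αβ = α⊆β (ArcInv-endpoints α-normalised)
  βα = β⊆α (ArcInv-endpoints β-normalised)
  bot≡ = Finₚ.≤-antisym (ArcInv.bot≤lower βα) (ArcInv.bot≤lower αβ)
  top≡ = Finₚ.≤-antisym (ArcInv.upper≤top αβ) (ArcInv.upper≤top βα)
  open Normalised α-normalised
  left≡ : ∀ c → Between α c → left α c ≡ left β c
  left≡ c (bot<c , c<top) with bool-cases (left α c)
  ... | inj₁ c-right = trans c-right (sym (ArcInv.lower-right (α⊆β (arcInv (ℕₚ.<⇒≤ bot<c) c<top Finₚ.≤-refl top-left c-right))))
  ... | inj₂ c-left = trans c-left (sym (ArcInv.upper-left (α⊆β (arcInv Finₚ.≤-refl bot<c (ℕₚ.<⇒≤ c<top) c-left bot-right))))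

-- The permutation of pairwise uncrossed arcs

module FromArcs {n m} (A : Fin m → Arc n) (A-normalised : ∀ f → Normalised (A f))
                (A-uncrossed : ∀ {e f} → e ≢ f → Uncrossed (A e) (A f)) where

  ArcsInv : Rel (Fin n) 0ℓ
  ArcsInv a b = ∃ λ f → ArcInv (A f) a b

  module ArcInvOf f = IsInversionSet (ArcInv-isInversionSet (A f))

  ArcsInv-isInversionBase : IsInversionBase ArcsInv
  ArcsInv-isInversionBase = record
    { dec          = λ a b → Finₚ.any? (λ f → ArcInvOf.dec f a b)
    ; descending   = λ (f , ab) → ArcInvOf.descending f ab
    ; cotransitive = λ (f , ac) c<b b<a → Sum.map (f ,_) (f ,_) (ArcInvOf.cotransitive f ac c<b b<a)
    }

  Path : Rel (Fin n) 0ℓ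
  Path = TransClosure ArcsInv

  private
    Path-isInversionSet = closure-isInversionSet ArcsInv-isInversionBase

  x : Perm n
  x = realise Path-isInversionSet

  Path-descending : ∀ {a b} → Path a b → b < a
  Path-descending = IsInversionSet.descending Path-isInversionSet

  Path⇒Before : ∀ {a b} → Path a b → Before x a b
  Path⇒Before = Inv⇒Before x ∘ Inv-realise⁺ Path-isInversionSet

  Before⇒Path : ∀ {a b} → Before x a b → b < a → Path a b
  Before⇒Path before b<a = Inv-realise⁻ Path-isInversionSet (Before⇒Inv x before b<a)

  module OfArc (e : Fin m) where
    α = A e
    p = top α
    q = bot α
    open Normalised (A-normalised e)

    q<p : q < p
    q<p = bot<top α

    -- the only step crossing α from its right (or top) to its left (or bottom) is α's own
    crossing-step : ∀ {f a b} → ArcInv (A f) a b → q ≤ b → a ≤ p →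
                    b ≡ q ⊎ left α b ≡ true → a ≡ p ⊎ left α a ≡ false → f ≡ e
    crossing-step {f} ab q≤b a≤p b-side a-side = decidable-stable (f ≟ e) λ f≢e →
      ArcInv-uncrossed (A-normalised e) (A-uncrossed (f≢e ∘ sym)) ab q≤b a≤p b-side a-side

    step-right : ∀ {a b} → ArcsInv a b → q ≤ b → a ≤ p → a ≡ p ⊎ left α a ≡ false → left α b ≡ false
    step-right {b = b} (f , ab) q≤b a≤p a-side with bool-cases (left α b)
    ... | inj₁ b-right = b-right
    ... | inj₂ b-left with crossing-step ab q≤b a≤p (inj₂ b-left) a-side
    ...   | refl = ⊥-elim (≡true⇒≢false b-left (ArcInv.lower-right ab))

    stays-right : ∀ {a b} → Path a b → q ≤ b → a ≤ p → a ≡ p ⊎ left α a ≡ false → left α b ≡ false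
    stays-right [ ab ] = step-right ab
    stays-right (ac ∷ cb) q≤b a≤p a-side =
      stays-right cb q≤b (ℕₚ.<⇒≤ (ℕₚ.<-≤-trans (Path-descending [ ac ]) a≤p))
                  (inj₂ (step-right ac (ℕₚ.<⇒≤ (ℕₚ.≤-<-trans q≤b (Path-descending cb))) a≤p a-side))

    no-path-to-left : ∀ {w} → q < w → left α w ≡ true → ¬ Path p w
    no-path-to-left q<w w-left p-w = ≡true⇒≢false w-left (stays-right p-w (ℕₚ.<⇒≤ q<w) Finₚ.≤-refl (inj₁ refl))

    no-path-from-right : ∀ {w} → w ≤ p → left α w ≡ false → ¬ Path w q
    no-path-from-right w≤p w-right [ (f , wq) ] with crossing-step wq Finₚ.≤-refl w≤p (inj₁ refl) (inj₂ w-right)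
    ... | refl = ≡true⇒≢false (ArcInv.upper-left wq) w-right
    no-path-from-right w≤p w-right (wc ∷ cq) =
      no-path-from-right c≤p (step-right wc (ℕₚ.<⇒≤ (Path-descending cq)) w≤p (inj₂ w-right)) cq
      where c≤p = ℕₚ.<⇒≤ (ℕₚ.<-≤-trans (Path-descending [ wc ]) w≤p)

    not-own : ∀ {f a b} → ArcInv (A f) a b → p < a ⊎ b < q → f ≢ e
    not-own ab (inj₁ p<a) refl = ℕₚ.<⇒≱ p<a (ArcInv.upper≤top ab)
    not-own ab (inj₂ b<q) refl = ℕₚ.<⇒≱ b<q (ArcInv.bot≤lower ab)

    above-top : ∀ {a} → Path a q → p < a → Path a p
    above-top [ (f , aq) ] p<a = case ArcInvOf.cotransitive f aq q<p p<a of λ where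
      (inj₁ ap) → [ (f , ap) ]
      (inj₂ pq) → ⊥-elim (not-own aq (inj₁ p<a) (crossing-step pq Finₚ.≤-refl Finₚ.≤-refl (inj₁ refl) (inj₁ refl)))
    above-top (_∷_ {y = c} (f , ac) cq) p<a with Finₚ.<-cmp c p
    ... | tri≈ _ refl _ = [ (f , ac) ]
    ... | tri> _ _ p<c = (f , ac) ∷ above-top cq p<c
    ... | tri< c<p _ _ with ArcInvOf.cotransitive f ac c<p p<a
    ...   | inj₁ ap = [ (f , ap) ]
    ...   | inj₂ pc with bool-cases (left α c)
    ...     | inj₁ c-right = ⊥-elim (no-path-from-right (ℕₚ.<⇒≤ c<p) c-right cq)
    ...     | inj₂ c-left = ⊥-elim (not-own ac (inj₁ p<a)
                              (crossing-step pc (ℕₚ.<⇒≤ (Path-descending cq)) Finₚ.≤-refl (inj₂ c-left) (inj₁ refl)))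

    step-to-bot : ∀ {f a} → a ≡ p ⊎ Path p a → q < a → ArcInv (A f) a q → f ≡ e
    step-to-bot (inj₁ refl) _ aq = crossing-step aq Finₚ.≤-refl Finₚ.≤-refl (inj₁ refl) (inj₁ refl)
    step-to-bot {a = a} (inj₂ p-a) q<a aq with bool-cases (left α a)
    ... | inj₁ a-right = crossing-step aq Finₚ.≤-refl (ℕₚ.<⇒≤ (Path-descending p-a)) (inj₁ refl) (inj₂ a-right)
    ... | inj₂ a-left = ⊥-elim (no-path-to-left q<a a-left p-a)

    below-bot : ∀ {a w} → a ≡ p ⊎ Path p a → q < a → Path a w → w < q → Path q w
    below-bot reach q<a [ (f , aw) ] w<q = case ArcInvOf.cotransitive f aw w<q q<a of λ where
      (inj₁ aq) → ⊥-elim (not-own aw (inj₂ w<q) (step-to-bot reach q<a aq))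
      (inj₂ qw) → [ (f , qw) ]
    below-bot reach q<a (_∷_ {y = c} (f , ac) cw) w<q with Finₚ.<-cmp c q
    ... | tri≈ _ refl _ = cw
    ... | tri> _ _ q<c = below-bot (inj₂ (extend reach)) q<c cw w<q
      where
      extend : _ ≡ p ⊎ Path p _ → Path p c
      extend (inj₁ refl) = [ (f , ac) ]
      extend (inj₂ p-a) = p-a ∷ʳ (f , ac)
    ... | tri< c<q _ _ = case ArcInvOf.cotransitive f ac c<q q<a of λ where
      (inj₁ aq) → ⊥-elim (not-own ac (inj₂ c<q) (step-to-bot reach q<a aq))
      (inj₂ qc) → (f , qc) ∷ cw

    adjacent : ∀ {w} → Before x p w → ¬ Before x w q
    adjacent {w} p-w w-q with Finₚ.<-cmp w p
    ... | tri≈ _ refl _ = Finₚ.<-irrefl refl p-w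
    ... | tri> _ _ p<w = Finₚ.<-asym p-w (Path⇒Before (above-top (Before⇒Path w-q (Finₚ.<-trans q<p p<w)) p<w))
    ... | tri< w<p _ _ with Finₚ.<-cmp w q
    ...   | tri< w<q _ _ = Finₚ.<-asym w-q (Path⇒Before (below-bot (inj₁ refl) q<p (Before⇒Path p-w w<p) w<q))
    ...   | tri≈ _ refl _ = Finₚ.<-irrefl refl w-q
    ...   | tri> _ _ q<w with bool-cases (left α w)
    ...     | inj₁ w-right = no-path-from-right (ℕₚ.<⇒≤ w<p) w-right (Before⇒Path w-q q<w)
    ...     | inj₂ w-left = no-path-to-left q<w w-left (Before⇒Path p-w w<p)

    position : Fin n
    position = x ⟨$⟩ˡ p

    p-before-q : Before x p q
    p-before-q = Path⇒Before [ (e , ArcInv-endpoints (A-normalised e)) ]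

    consecutive : toℕ (x ⟨$⟩ˡ q) ≡ suc (toℕ position)
    consecutive = decidable-stable (toℕ (x ⟨$⟩ˡ q) ℕₚ.≟ suc (toℕ position)) λ not-next →
      let next<q = ℕₚ.≤∧≢⇒< p-before-q (not-next ∘ sym)
          next = fromℕ< (ℕₚ.<-trans next<q (Finₚ.toℕ<n (x ⟨$⟩ˡ q)))
          toℕ-next = trans (cong toℕ (inverseˡ x)) (Finₚ.toℕ-fromℕ< _)
      in adjacent {x ⟨$⟩ʳ next} (subst (toℕ position ℕ.<_) (sym toℕ-next) (ℕₚ.n<1+n _))
                                 (subst (ℕ._< toℕ (x ⟨$⟩ˡ q)) (sym toℕ-next) next<q)

    descent : Descent x position
    descent = x ⟨$⟩ˡ q , consecutive , subst₂ _<_ (sym (inverseʳ x)) (sym (inverseʳ x)) q<p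

    ≈descentArc : α ≈ₐ descentArc x descent
    ≈descentArc = sym (inverseʳ x) , sym (inverseʳ x) , same-side
      where
      same-side : ∀ c → Between α c → left α c ≡ left (descentArc x descent) c
      same-side c (q<c , c<p) with bool-cases (left α c)
      ... | inj₁ c-right = trans c-right (sym (DescentArc.right⁺ x descent
              (Path⇒Before [ (e , arcInv (ℕₚ.<⇒≤ q<c) c<p Finₚ.≤-refl top-left c-right) ])))
      ... | inj₂ c-left = trans c-left (sym (DescentArc.left⁺ x descent (ℕₚ.≤-pred (subst (toℕ (x ⟨$⟩ˡ c) ℕ.<_) consecutive
              (Path⇒Before [ (e , arcInv Finₚ.≤-refl q<c (ℕₚ.<⇒≤ c<p) c-left bot-right) ])))))

  enumeration : DescentEnumeration x (λ f → ArcInv (A f))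
  enumeration = record
    { position            = OfArc.position
    ; descent             = OfArc.descent
    ; ⊆ArcInv             = λ e → ArcInv-resp-≈ₐ (OfArc.≈descentArc e) (A-normalised e) (normalised e)
    ; ArcInv⊆             = λ e → ArcInv-resp-≈ₐ (≈ₐ-sym {α = A e} {descentArc x (OfArc.descent e)} (OfArc.≈descentArc e))
                                                 (normalised e) (A-normalised e)
    ; position-injective  = λ {e} {f} same → decidable-stable (e ≟ f) λ e≢f →
                              Uncrossed.tops-differ (A-uncrossed e≢f) (⟨$⟩ˡ-injective x same)
    ; position-surjective = λ desc → single-step desc (Inv-realise⁻ Path-isInversionSet
                              (DescentArc.ArcInv⇒Inv x desc (ArcInv-endpoints (DescentArc.normalised x desc))))
    }
    where
    normalised : ∀ e → Normalised (descentArc x (OfArc.descent e))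
    normalised e = DescentArc.normalised x (OfArc.descent e)

    single-step : ∀ {d} (desc : Descent x d) → Path (top (descentArc x desc)) (bot (descentArc x desc)) →
                  ∃ λ e → OfArc.position e ≡ d
    single-step desc [ (f , ab) ] = f , descentArc-unique x desc (OfArc.descent f)
                                         (ArcInv-resp-≈ₐ (OfArc.≈descentArc f) (A-normalised f) (normalised f) ab)
    single-step desc (ac ∷ cb) = ⊥-elim (DescentArc.adjacent x desc (Path⇒Before [ ac ]) (Path⇒Before cb))

-- Noncrossing arc diagrams

lvl-mono : ∀ {n} {a b : Fin n} → a ≤ b → lvl a ℕ.≤ lvl b
lvl-mono = ℕₚ.*-monoʳ-≤ 2

lvl-mono-< : ∀ {n} {a b : Fin n} → a < b → lvl a ℕ.< lvl b
lvl-mono-< = ℕₚ.*-monoʳ-< 2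

⌊lvl/2⌋ : ∀ {n} (c : Fin n) → ⌊ lvl c /2⌋ ≡ toℕ c
⌊lvl/2⌋ c = sym (trans (ℕₚ.n≡⌊n+n/2⌋ (toℕ c)) (cong ⌊_/2⌋ (cong (toℕ c +_) (sym (ℕₚ.+-identityʳ (toℕ c))))))

-- The arc of the descent at position d crosses the level of a point c (odd levels use the
-- point below) at abscissa 2 (position of c) − (2 d + 1), except at its endpoints, where it
-- is 0; so it passes left of c exactly when c precedes the descent.
module DescentDiagram {n} (x : Perm n) (E : List (Arc n))
  (position : Fin (length E) → Fin n) (descent : ∀ k → Descent x (position k))
  (≈descentArc : ∀ k → lookup E k ≈ₐ descentArc x (descent k))
  (position-injective : ∀ {k l} → position k ≡ position l → k ≡ l) where

  private
    δ : Fin (length E) → Arc n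
    δ k = descentArc x (descent k)

    column : Fin (length E) → ℕ
    column k = 2 * toℕ (position k) + 1

    -- the point at the height of level ℓ (junk above the top point)
    pointAt : Fin (length E) → ℕ → Fin n
    pointAt k ℓ with ⌊ ℓ /2⌋ ℕ.<? n
    ... | yes lt = fromℕ< lt
    ... | no _ = position k

    abscissa : Fin (length E) → ℕ → ℕ
    abscissa k ℓ = 2 * toℕ (x ⟨$⟩ˡ pointAt k ℓ)

    shifted : Fin (length E) → ℕ → ℕ
    shifted k ℓ with ℓ ℕₚ.≟ lvl (bot (δ k)) | ℓ ℕₚ.≟ lvl (top (δ k))
    ... | yes _ | _ = column k
    ... | no _ | yes _ = column k
    ... | no _ | no _ = abscissa k ℓ

    P : Fin (length E) → ℕ → ℤ
    P k ℓ = shifted k ℓ ⊖ column k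

    shifted-endpoint : ∀ k ℓ → ℓ ≡ lvl (bot (δ k)) ⊎ ℓ ≡ lvl (top (δ k)) → shifted k ℓ ≡ column k
    shifted-endpoint k ℓ endpoint with ℓ ℕₚ.≟ lvl (bot (δ k)) | ℓ ℕₚ.≟ lvl (top (δ k))
    ... | yes _ | _ = refl
    ... | no _ | yes _ = refl
    ... | no ≢bot | no ≢top = ⊥-elim ([ ≢bot , ≢top ]′ endpoint)

    shifted-interior : ∀ k ℓ → ℓ ≢ lvl (bot (δ k)) → ℓ ≢ lvl (top (δ k)) → shifted k ℓ ≡ abscissa k ℓ
    shifted-interior k ℓ ≢bot ≢top with ℓ ℕₚ.≟ lvl (bot (δ k)) | ℓ ℕₚ.≟ lvl (top (δ k))
    ... | yes ≡bot | _ = contradiction ≡bot ≢bot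
    ... | no _ | yes ≡top = contradiction ≡top ≢top
    ... | no _ | no _ = refl

    pointAt-lvl : ∀ k c → pointAt k (lvl c) ≡ c
    pointAt-lvl k c with ⌊ lvl c /2⌋ ℕ.<? n
    ... | yes lt = Finₚ.toℕ-injective (trans (Finₚ.toℕ-fromℕ< lt) (⌊lvl/2⌋ c))
    ... | no ≮n = contradiction (subst (ℕ._< n) (sym (⌊lvl/2⌋ c)) (Finₚ.toℕ<n c)) ≮n

    pointAt-irrelevant : ∀ k l ℓ → ⌊ ℓ /2⌋ ℕ.< n → pointAt k ℓ ≡ pointAt l ℓ
    pointAt-irrelevant k l ℓ lt with ⌊ ℓ /2⌋ ℕ.<? n
    ... | yes _ = refl
    ... | no ≮n = contradiction lt ≮n

    abscissa-lvl : ∀ k c → abscissa k (lvl c) ≡ 2 * toℕ (x ⟨$⟩ˡ c)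
    abscissa-lvl k c = cong (λ p → 2 * toℕ (x ⟨$⟩ˡ p)) (pointAt-lvl k c)

    abscissa-irrelevant : ∀ k l ℓ → ℓ ℕ.≤ lvl (top (δ k)) → abscissa k ℓ ≡ abscissa l ℓ
    abscissa-irrelevant k l ℓ ℓ≤top = cong (λ p → 2 * toℕ (x ⟨$⟩ˡ p)) (pointAt-irrelevant k l ℓ
      (ℕₚ.≤-<-trans (ℕₚ.≤-trans (ℕₚ.⌊n/2⌋-mono ℓ≤top) (ℕₚ.≤-reflexive (⌊lvl/2⌋ (top (δ k))))) (Finₚ.toℕ<n _)))

    shifted-close : ∀ k ℓ → shifted k ℓ ℕ.≤ abscissa k ℓ + 1 × abscissa k ℓ ℕ.≤ shifted k ℓ + 1
    shifted-close k ℓ with ℓ ℕₚ.≟ lvl (bot (δ k)) | ℓ ℕₚ.≟ lvl (top (δ k))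
    ... | yes refl | _ rewrite abscissa-lvl k (bot (δ k)) | DescentArc.position-bot x (descent k) =
      ℕₚ.≤-trans (ℕₚ.m≤m+n _ 2) (ℕₚ.≤-reflexive (2*[1+d]+1 (toℕ (position k))))
      , ℕₚ.≤-reflexive (2*[1+d] (toℕ (position k)))
      where
      2*[1+d]+1 : ∀ d → 2 * d + 1 + 2 ≡ 2 * suc d + 1
      2*[1+d]+1 = solve-∀
      2*[1+d] : ∀ d → 2 * suc d ≡ 2 * d + 1 + 1
      2*[1+d] = solve-∀
    ... | no _ | yes refl rewrite abscissa-lvl k (top (δ k)) | DescentArc.position-top x (descent k) =
      ℕₚ.≤-refl , ℕₚ.≤-trans (ℕₚ.m≤m+n _ 1) (ℕₚ.m≤m+n _ 1)
    ... | no _ | no _ = ℕₚ.m≤m+n _ 1 , ℕₚ.m≤m+n _ 1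

    P-antitone : ∀ k l ℓ → position k < position l → ℓ ℕ.≤ lvl (top (δ k)) → P l ℓ ℤ.≤ P k ℓ
    P-antitone k l ℓ k<l ℓ≤top = ⊖-≤ {shifted l ℓ} {column l} {shifted k ℓ} {column k} (begin
      shifted l ℓ + column k           ≤⟨ ℕₚ.+-monoˡ-≤ (column k) (proj₁ (shifted-close l ℓ)) ⟩
      abscissa l ℓ + 1 + column k      ≡⟨ cong (λ a → a + 1 + column k) (abscissa-irrelevant k l ℓ ℓ≤top) ⟨
      abscissa k ℓ + 1 + column k      ≤⟨ ℕₚ.+-monoˡ-≤ (column k) (ℕₚ.+-monoˡ-≤ 1 (proj₂ (shifted-close k ℓ))) ⟩
      shifted k ℓ + 1 + 1 + column k   ≡⟨ rearrange (shifted k ℓ) (toℕ (position k)) ⟩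
      shifted k ℓ + (2 * suc (toℕ (position k)) + 1) ≤⟨ ℕₚ.+-monoʳ-≤ (shifted k ℓ) (ℕₚ.+-monoˡ-≤ 1 (ℕₚ.*-monoʳ-≤ 2 k<l)) ⟩
      shifted k ℓ + column l           ∎)
      where
      open ℕₚ.≤-Reasoning
      rearrange : ∀ s d → s + 1 + 1 + (2 * d + 1) ≡ s + (2 * suc d + 1)
      rearrange = solve-∀

    P-interior : ∀ k c → Between (δ k) c → P k (lvl c) ≡ (2 * toℕ (x ⟨$⟩ˡ c)) ⊖ column k
    P-interior k c (bot<c , c<top) = cong (_⊖ column k) (trans
      (shifted-interior k (lvl c) (ℕₚ.<⇒≢ (lvl-mono-< bot<c) ∘ sym) (ℕₚ.<⇒≢ (lvl-mono-< c<top)))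
      (abscissa-lvl k c))

    P-endpoint : ∀ k ℓ → ℓ ≡ lvl (bot (δ k)) ⊎ ℓ ≡ lvl (top (δ k)) → P k ℓ ≡ 0ℤ
    P-endpoint k ℓ endpoint = trans (cong (_⊖ column k) (shifted-endpoint k ℓ endpoint)) (ℤₚ.n⊖n≡0 (column k))

    1+[2d+1] : ∀ d → suc (2 * d + 1) ≡ 2 * suc d
    1+[2d+1] = solve-∀

    sides-δ : ∀ k c → Between (δ k) c → if left (δ k) c then P k (lvl c) ℤ.< 0ℤ else 0ℤ ℤ.< P k (lvl c)
    sides-δ k c between = case toℕ (x ⟨$⟩ˡ c) ℕₚ.≤? toℕ (position k) of λ where
      (yes c≤d) → subst (λ b → if b then P k (lvl c) ℤ.< 0ℤ else 0ℤ ℤ.< P k (lvl c))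
                    (sym (DescentArc.left⁺ x (descent k) c≤d))
                    (subst (ℤ._< 0ℤ) (sym (P-interior k c between))
                      (⊖-neg (ℕₚ.≤-<-trans (ℕₚ.*-monoʳ-≤ 2 c≤d) (ℕₚ.m<m+n _ (s≤s z≤n)))))
      (no c≰d) → subst (λ b → if b then P k (lvl c) ℤ.< 0ℤ else 0ℤ ℤ.< P k (lvl c))
                    (sym (DescentArc.right⁺ x (descent k) (ℕₚ.≰⇒> c≰d)))
                    (subst (0ℤ ℤ.<_) (sym (P-interior k c between))
                      (⊖-pos (ℕₚ.<-≤-trans (ℕₚ.≤-reflexive (1+[2d+1] (toℕ (position k))))
                                           (ℕₚ.*-monoʳ-≤ 2 (ℕₚ.≰⇒> c≰d)))))

    bot≡ : ∀ k → bot (lookup E k) ≡ bot (δ k)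
    bot≡ k = proj₁ (≈descentArc k)

    top≡ : ∀ k → top (lookup E k) ≡ top (δ k)
    top≡ k = proj₁ (proj₂ (≈descentArc k))

    P-inside : ∀ k ℓ → Inside (lookup E k) ℓ → P k ℓ ≡ abscissa k ℓ ⊖ column k
    P-inside k ℓ (bot<ℓ , ℓ<top) = cong (_⊖ column k) (shifted-interior k ℓ
      (ℕₚ.<⇒≢ (subst (λ b → lvl b ℕ.< ℓ) (bot≡ k) bot<ℓ) ∘ sym) (ℕₚ.<⇒≢ (subst (λ t → ℓ ℕ.< lvl t) (top≡ k) ℓ<top)))

    column-injective : ∀ {k l} → column k ≡ column l → k ≡ l
    column-injective = position-injective ∘ Finₚ.toℕ-injective ∘ ℕₚ.*-cancelˡ-≡ _ _ 2 ∘ ℕₚ.+-cancelʳ-≡ 1 _ _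

    P-apart : ∀ k l → k ≢ l → ∀ ℓ → Inside (lookup E k) ℓ → Inside (lookup E l) ℓ → P k ℓ ≢ P l ℓ
    P-apart k l k≢l ℓ k-inside l-inside P≡ = k≢l (column-injective (⊖-injectiveʳ (abscissa k ℓ) (begin
      abscissa k ℓ ⊖ column k   ≡⟨ P-inside k ℓ k-inside ⟨
      P k ℓ                     ≡⟨ P≡ ⟩
      P l ℓ                     ≡⟨ P-inside l ℓ l-inside ⟩
      abscissa l ℓ ⊖ column l   ≡⟨ cong (_⊖ column l) (abscissa-irrelevant k l ℓ ℓ≤top) ⟨
      abscissa k ℓ ⊖ column l   ∎)))
      where
      open ≡-Reasoning
      ℓ≤top = ℕₚ.<⇒≤ (subst (λ t → ℓ ℕ.< lvl t) (top≡ k) (proj₂ k-inside))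

    P-no-swap : ∀ k l ℓ → Within (lookup E k) ℓ → Within (lookup E k) (suc ℓ) →
                Within (lookup E l) ℓ → Within (lookup E l) (suc ℓ) → ¬ (P k ℓ ℤ.< P l ℓ × P l (suc ℓ) ℤ.< P k (suc ℓ))
    P-no-swap k l ℓ _ (_ , sucℓ≤top) _ (_ , sucℓ≤top′) (k<l-at-ℓ , l<k-at-sucℓ) with Finₚ.<-cmp (position k) (position l)
    ... | tri< k<l _ _ = ℤₚ.<⇒≱ k<l-at-ℓ (P-antitone k l ℓ k<l (ℕₚ.<⇒≤ (subst (λ t → ℓ ℕ.< lvl t) (top≡ k) sucℓ≤top)))
    ... | tri> _ _ l<k = ℤₚ.<⇒≱ l<k-at-sucℓ (P-antitone l k (suc ℓ) l<k (subst (λ t → suc ℓ ℕ.≤ lvl t) (top≡ l) sucℓ≤top′))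
    ... | tri≈ _ same _ with position-injective same
    ...   | refl = ℤₚ.<-irrefl refl k<l-at-ℓ

  diagram : NoncrossingArcDiagram n
  diagram = record
    { arcs         = E
    ; pos          = P
    ; distinct-top = λ k l tops≡ → position-injective (⟨$⟩ʳ-injective x (trans (sym (top≡ k)) (trans tops≡ (top≡ l))))
    ; distinct-bot = λ k l bots≡ → position-injective (Finₚ.toℕ-injective (ℕₚ.suc-injective
                       (trans (sym (DescentArc.position-bot x (descent k)))
                         (trans (cong (toℕ ∘ (x ⟨$⟩ˡ_)) (trans (sym (bot≡ k)) (trans bots≡ (bot≡ l))))
                                (DescentArc.position-bot x (descent l))))))
    ; at-bot       = λ k → P-endpoint k _ (inj₁ (cong lvl (bot≡ k)))
    ; at-top       = λ k → P-endpoint k _ (inj₂ (cong lvl (top≡ k)))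
    ; sides        = λ k c between → subst (λ b → if b then P k (lvl c) ℤ.< 0ℤ else 0ℤ ℤ.< P k (lvl c))
                       (sym (proj₂ (proj₂ (≈descentArc k)) c between))
                       (sides-δ k c (subst (_< c) (bot≡ k) (proj₁ between) , subst (c <_) (top≡ k) (proj₂ between)))
    ; apart        = P-apart
    ; no-swap      = P-no-swap
    }

-- Arcs of noncrossing diagrams are uncrossed

SidePosition : ℕ → ℤ → Set
SidePosition 0 z = z ℤ.< 0ℤ
SidePosition 1 z = z ≡ 0ℤ
SidePosition 2 z = 0ℤ ℤ.< z
SidePosition _ _ = ⊥

SidePosition-< : ∀ {s s′ z z′} → s ℕ.< s′ → SidePosition s z → SidePosition s′ z′ → z ℤ.< z′
SidePosition-< {0} {1} _ z<0 refl = z<0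
SidePosition-< {0} {2} _ z<0 0<z′ = ℤₚ.<-trans z<0 0<z′
SidePosition-< {1} {2} _ refl 0<z′ = 0<z′
SidePosition-< {1} {1} (s≤s ()) _ _
SidePosition-< {2} {1} (s≤s ()) _ _
SidePosition-< {2} {2} (s≤s (s≤s ())) _ _
SidePosition-< {0} {suc (suc (suc _))} _ _ ()
SidePosition-< {1} {suc (suc (suc _))} _ _ ()
SidePosition-< {2} {suc (suc (suc _))} _ _ ()
SidePosition-< {suc (suc (suc _))} _ ()

side-sign : ∀ b {z} → (if b then z ℤ.< 0ℤ else 0ℤ ℤ.< z) → SidePosition (if b then 0 else 2) z
side-sign true  z<0 = z<0
side-sign false 0<z = 0<z

side-sign-nonzero : ∀ b {z} → (if b then z ℤ.< 0ℤ else 0ℤ ℤ.< z) → z ≢ 0ℤ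
side-sign-nonzero true  z<0 = ℤₚ.<⇒≢ z<0
side-sign-nonzero false 0<z = ℤₚ.<⇒≢ 0<z ∘ sym

module DiagramUncrossed {n} (D : NoncrossingArcDiagram n) where
  private
    P = pos D
    α = arc D

  side-position : ∀ e {c} → InRange (α e) c → SidePosition (side (α e) c) (P e (lvl c))
  side-position e {c} (bot≤c , c≤top) = case ((c ≟ bot (α e)) ,′ (c ≟ top (α e))) of λ where
    (yes c≡bot , _) → subst (λ c → SidePosition (side (α e) c) (P e (lvl c))) (sym c≡bot)
                        (subst₂ SidePosition (sym (side-bot (α e))) (sym (at-bot D e)) refl)
    (no _ , yes c≡top) → subst (λ c → SidePosition (side (α e) c) (P e (lvl c))) (sym c≡top)
                        (subst₂ SidePosition (sym (side-top (α e))) (sym (at-top D e)) refl)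
    (no c≢bot , no c≢top) → subst (λ s → SidePosition s (P e (lvl c))) (sym (side-interior (α e) c≢bot c≢top))
                        (side-sign (left (α e) c)
                          (sides D e c (Finₚ.≤∧≢⇒< bot≤c (c≢bot ∘ sym) , Finₚ.≤∧≢⇒< c≤top c≢top)))

  -- at the top of e the arc f (reaching higher) passes strictly beside the point
  top-untouched : ∀ {e f} → e ≢ f → lvl (bot (α f)) ℕ.< lvl (top (α e)) → lvl (top (α e)) ℕ.≤ lvl (top (α f)) →
                  P e (lvl (top (α e))) ≢ P f (lvl (top (α e)))
  top-untouched {e} {f} e≢f bot<top top≤top touch with Finₚ.<-cmp (top (α e)) (top (α f))
  ... | tri≈ _ tops≡ _ = e≢f (distinct-top D e f tops≡)
  ... | tri> _ _ gt = ℕₚ.<⇒≱ (lvl-mono-< gt) top≤top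
  ... | tri< lt _ _ = side-sign-nonzero (left (α f) (top (α e))) (sides D f _ (ℕₚ.*-cancelˡ-< 2 _ _ bot<top , lt))
                        (trans (sym touch) (at-top D e))

  untouched : ∀ {e f} → e ≢ f → ∀ ℓ → lvl (bot (α e)) ℕ.< ℓ → lvl (bot (α f)) ℕ.< ℓ →
              ℓ ℕ.≤ lvl (top (α e)) → ℓ ℕ.≤ lvl (top (α f)) → P e ℓ ≢ P f ℓ
  untouched {e} {f} e≢f ℓ bot<ℓ bot<ℓ′ ℓ≤top ℓ≤top′ with ℓ ℕₚ.≟ lvl (top (α e)) | ℓ ℕₚ.≟ lvl (top (α f))
  ... | yes refl | _ = top-untouched e≢f bot<ℓ′ ℓ≤top′
  ... | no _ | yes refl = top-untouched (e≢f ∘ sym) bot<ℓ ℓ≤top ∘ sym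
  ... | no ℓ≢top | no ℓ≢top′ = apart D e f e≢f ℓ (bot<ℓ , ℕₚ.≤∧≢⇒< ℓ≤top ℓ≢top) (bot<ℓ′ , ℕₚ.≤∧≢⇒< ℓ≤top′ ℓ≢top′)

  stays-left : ∀ {e f} → e ≢ f → ∀ {ℓ} k → Within (α e) ℓ → Within (α f) ℓ →
               k + ℓ ℕ.≤ lvl (top (α e)) → k + ℓ ℕ.≤ lvl (top (α f)) → P e ℓ ℤ.< P f ℓ → P e (k + ℓ) ℤ.< P f (k + ℓ)
  stays-left e≢f zero _ _ _ _ e<f = e<f
  stays-left {e} {f} e≢f {ℓ} (suc k) we@(bot≤ℓ , _) wf@(bot≤ℓ′ , _) top≥ top≥′ e<f
    with ℤₚ.<-cmp (P e (suc k + ℓ)) (P f (suc k + ℓ))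
  ... | tri< e<f′ _ _ = e<f′
  ... | tri≈ _ touch _ = ⊥-elim (untouched e≢f (suc k + ℓ) (s≤s (ℕₚ.≤-trans bot≤ℓ (ℕₚ.m≤n+m ℓ k)))
                                   (s≤s (ℕₚ.≤-trans bot≤ℓ′ (ℕₚ.m≤n+m ℓ k))) top≥ top≥′ touch)
  ... | tri> _ _ f<e′ = ⊥-elim (no-swap D e f (k + ℓ)
                          (ℕₚ.≤-trans bot≤ℓ (ℕₚ.m≤n+m ℓ k) , ℕₚ.<⇒≤ top≥) (ℕₚ.≤-trans bot≤ℓ (ℕₚ.m≤n+m ℓ (suc k)) , top≥)
                          (ℕₚ.≤-trans bot≤ℓ′ (ℕₚ.m≤n+m ℓ k) , ℕₚ.<⇒≤ top≥′) (ℕₚ.≤-trans bot≤ℓ′ (ℕₚ.m≤n+m ℓ (suc k)) , top≥′)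
                          (stays-left e≢f k we wf (ℕₚ.<⇒≤ top≥) (ℕₚ.<⇒≤ top≥′) e<f , f<e′))

  stays-left-upto : ∀ {e f} → e ≢ f → ∀ {c c′} → c ≤ c′ → InRange (α e) c → InRange (α f) c →
                    InRange (α e) c′ → InRange (α f) c′ → P e (lvl c) ℤ.< P f (lvl c) → P e (lvl c′) ℤ.< P f (lvl c′)
  stays-left-upto {e} {f} e≢f {c} {c′} c≤c′ (bot≤c , _) (bot≤c′ , _) (_ , c′≤top) (_ , c′≤top′) e<f =
    subst (λ ℓ → P e ℓ ℤ.< P f ℓ) lvl≡
      (stays-left e≢f (lvl c′ ∸ lvl c)
        (lvl-mono bot≤c , lvl-mono (ℕₚ.≤-trans c≤c′ c′≤top)) (lvl-mono bot≤c′ , lvl-mono (ℕₚ.≤-trans c≤c′ c′≤top′))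
        (ℕₚ.≤-trans (ℕₚ.≤-reflexive lvl≡) (lvl-mono c′≤top)) (ℕₚ.≤-trans (ℕₚ.≤-reflexive lvl≡) (lvl-mono c′≤top′))
        e<f)
    where
    lvl≡ : lvl c′ ∸ lvl c + lvl c ≡ lvl c′
    lvl≡ = ℕₚ.m∸n+n≡m (lvl-mono c≤c′)

  arcs-uncrossed : ∀ {e f} → e ≢ f → Uncrossed (α e) (α f)
  arcs-uncrossed {e} {f} e≢f = record
    { tops-differ = e≢f ∘ distinct-top D e f
    ; bots-differ = e≢f ∘ distinct-bot D e f
    ; no-crossing = λ {c} {c′} ec fc ec′ fc′ e<f f<e →
        let P-e<f = SidePosition-< e<f (side-position e ec) (side-position f fc)
            P-f<e = SidePosition-< f<e (side-position f fc′) (side-position e ec′)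
        in case Finₚ.<-cmp c c′ of λ where
          (tri< c<c′ _ _) → ℤₚ.<-asym (stays-left-upto e≢f (ℕₚ.<⇒≤ c<c′) ec fc ec′ fc′ P-e<f) P-f<e
          (tri≈ _ refl _) → ℕₚ.<-asym e<f f<e
          (tri> _ _ c′<c) → ℤₚ.<-asym (stays-left-upto (e≢f ∘ sym) (ℕₚ.<⇒≤ c′<c) fc′ ec′ fc ec P-f<e) P-e<f
    }

arcAt : ∀ {n} (J : List (Perm n)) → All JoinIrreducible J → Fin (length J) → Arc n
arcAt J J-ji e = arcOf (lookup J e) (All-lookup J-ji e)

arcsOf-index : ∀ {n} (J : List (Perm n)) (J-ji : All JoinIrreducible J) → Fin (length (arcsOf J J-ji)) → Fin (length J)
arcsOf-index (_ ∷ _) (_ ∷ _) zero = zero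
arcsOf-index (_ ∷ J) (_ ∷ J-ji) (suc k) = suc (arcsOf-index J J-ji k)

lookup-arcsOf : ∀ {n} (J : List (Perm n)) (J-ji : All JoinIrreducible J) k →
  lookup (arcsOf J J-ji) k ≡ arcAt J J-ji (arcsOf-index J J-ji k)
lookup-arcsOf (_ ∷ _) (_ ∷ _) zero = refl
lookup-arcsOf (_ ∷ J) (_ ∷ J-ji) (suc k) = lookup-arcsOf J J-ji k

arcsOf-index-injective : ∀ {n} (J : List (Perm n)) (J-ji : All JoinIrreducible J) {k l} →
  arcsOf-index J J-ji k ≡ arcsOf-index J J-ji l → k ≡ l
arcsOf-index-injective (_ ∷ _) (_ ∷ _) {zero} {zero} _ = refl
arcsOf-index-injective (_ ∷ J) (_ ∷ J-ji) {suc k} {suc l} eq = cong suc (arcsOf-index-injective J J-ji (Finₚ.suc-injective eq))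

AllPairs-arcsOf : ∀ {n} {R : Arc n → Arc n → Set} (J : List (Perm n)) (J-ji : All JoinIrreducible J) →
  AllPairs R (arcsOf J J-ji) → ∀ {e f} → e < f → R (arcAt J J-ji e) (arcAt J J-ji f)
AllPairs-arcsOf (_ ∷ J) (_ ∷ J-ji) (Rα ∷ _) {zero} {suc f} _ = lookup-all J J-ji Rα f
  where
  lookup-all : ∀ {P : Arc _ → Set} J J-ji → All P (arcsOf J J-ji) → ∀ f → P (arcAt J J-ji f)
  lookup-all (_ ∷ _) (_ ∷ _) (Pα ∷ _) zero = Pα
  lookup-all (_ ∷ J) (_ ∷ J-ji) (_ ∷ Pαs) (suc f) = lookup-all J J-ji Pαs f
AllPairs-arcsOf (_ ∷ J) (_ ∷ J-ji) (_ ∷ Rαs) {suc e} {suc f} (s≤s e<f) = AllPairs-arcsOf J J-ji Rαs e<f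

DescentEnumeration-resp : ∀ {n m} {x : Perm n} {I I′ : Fin m → Rel (Fin n) 0ℓ} →
  (∀ e → I e ⇒ I′ e) → (∀ e → I′ e ⇒ I e) → DescentEnumeration x I → DescentEnumeration x I′
DescentEnumeration-resp I⊆I′ I′⊆I enum = record
  { position            = position
  ; descent             = descent
  ; ⊆ArcInv             = λ e → ⊆ArcInv e ∘ I′⊆I e
  ; ArcInv⊆             = λ e → I⊆I′ e ∘ ArcInv⊆ e
  ; position-injective  = position-injective
  ; position-surjective = position-surjective
  }
  where open DescentEnumeration enum

module _ {n} (J : List (Perm n)) (J-ji : All JoinIrreducible J) where
  private
    E = arcsOf J J-ji
    α = arcAt J J-ji

  PairwiseUncrossed : Set
  PairwiseUncrossed = ∀ {e f} → e ≢ f → Uncrossed (α e) (α f)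

  pairwiseUncrossed-from-< : (∀ {e f} → e < f → Uncrossed (α e) (α f)) → PairwiseUncrossed
  pairwiseUncrossed-from-< uncrossed-< {e} {f} e≢f with Finₚ.<-cmp e f
  ... | tri< e<f _ _ = uncrossed-< e<f
  ... | tri≈ _ e≡f _ = contradiction e≡f e≢f
  ... | tri> _ _ f<e = Uncrossed-sym (uncrossed-< f<e)

  uncrossed⇒canonical : PairwiseUncrossed → Σ[ x ∈ Perm n ] IsCanonicalJoinRep J x
  uncrossed⇒canonical uncrossed = FromArcs.x α α-normalised uncrossed , enumeration⇒canonical
    (DescentEnumeration-resp (λ e → ArcInv-arcOf⇒Inv (lookup J e) (All-lookup J-ji e))
                             (λ e → Inv⇒ArcInv-arcOf (lookup J e) (All-lookup J-ji e))
                             (FromArcs.enumeration α α-normalised uncrossed))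
    where
    α-normalised : ∀ e → Normalised (α e)
    α-normalised e = arcOf-normalised (lookup J e) (All-lookup J-ji e)

  canonical⇒diagram : Distinct J → Σ[ x ∈ Perm n ] IsCanonicalJoinRep J x →
                      Σ[ D ∈ NoncrossingArcDiagram n ] Pointwise _≈ₐ_ (arcs D) E
  canonical⇒diagram J-distinct (x , J-canonical) =
    DescentDiagram.diagram x E (position ∘ index) (descent ∘ index) ≈descentArc
                           (arcsOf-index-injective J J-ji ∘ position-injective)
    , Pointwise.refl (λ {_} → refl , refl , λ _ _ → refl)
    where
    open DescentEnumeration (canonical⇒enumeration {x = x} {J = J} J-ji J-distinct J-canonical)
    index = arcsOf-index J J-ji
    ≈descentArc : ∀ k → lookup E k ≈ₐ descentArc x (descent (index k))
    ≈descentArc k = subst (_≈ₐ descentArc x (descent (index k))) (sym (lookup-arcsOf J J-ji k))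
      (ArcInv-≈ₐ (arcOf-normalised (lookup J (index k)) (All-lookup J-ji (index k))) (DescentArc.normalised x (descent (index k)))
                 (⊆ArcInv (index k) ∘ ArcInv-arcOf⇒Inv (lookup J (index k)) (All-lookup J-ji (index k)))
                 (Inv⇒ArcInv-arcOf (lookup J (index k)) (All-lookup J-ji (index k)) ∘ ArcInv⊆ (index k)))

  diagram⇒compatible : Σ[ D ∈ NoncrossingArcDiagram n ] Pointwise _≈ₐ_ (arcs D) E → AllPairs Compatible E
  diagram⇒compatible (D , D≈E) = AllPairs-from-All (λ inD inD′ → D , inD , inD′)
    (All.map (λ {β} → Any.map (λ {γ} → ≈ₐ-sym {α = γ} {β})) (Pointwise⇒All-Any D≈E))

  compatible⇒uncrossed : Distinct J → AllPairs Compatible E → PairwiseUncrossed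
  compatible⇒uncrossed J-distinct compatible = pairwiseUncrossed-from-< λ {e} {f} e<f →
    uncrossed-in (AllPairs-arcsOf J J-ji compatible e<f) (Finₚ.<⇒≢ e<f)
    where
    same-arc⇒≈ₚ : ∀ {e f} → α e ≈ₐ α f → lookup J e ≈ₚ lookup J f
    same-arc⇒≈ₚ {e} {f} αe≈αf = Inv-injective (lookup J e) (lookup J f)
      (λ _ _ → ArcInv-arcOf⇒Inv (lookup J f) (All-lookup J-ji f)
               ∘ ArcInv-resp-≈ₐ αe≈αf (normalised e) (normalised f)
               ∘ Inv⇒ArcInv-arcOf (lookup J e) (All-lookup J-ji e))
      (λ _ _ → ArcInv-arcOf⇒Inv (lookup J e) (All-lookup J-ji e)
               ∘ ArcInv-resp-≈ₐ (≈ₐ-sym {α = α e} {α f} αe≈αf) (normalised f) (normalised e)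
               ∘ Inv⇒ArcInv-arcOf (lookup J f) (All-lookup J-ji f))
      where
      normalised : ∀ e → Normalised (α e)
      normalised e = arcOf-normalised (lookup J e) (All-lookup J-ji e)

    uncrossed-in : ∀ {e f} → Compatible (α e) (α f) → e ≢ f → Uncrossed (α e) (α f)
    uncrossed-in {e} {f} (D , e∈D , f∈D) e≢f = by-index (Any.index e∈D ≟ Any.index f∈D)
      where
      e≈D : α e ≈ₐ arc D (Any.index e∈D)
      e≈D = Anyₚ.lookup-index e∈D
      f≈D : α f ≈ₐ arc D (Any.index f∈D)
      f≈D = Anyₚ.lookup-index f∈D

      by-index : Dec (Any.index e∈D ≡ Any.index f∈D) → Uncrossed (α e) (α f)
      by-index (yes same) = ⊥-elim (Distinct-lookup J-distinct e≢f (same-arc⇒≈ₚ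
        (≈ₐ-trans {α = α e} {arc D (Any.index e∈D)} {α f} e≈D
          (subst (λ k → arc D k ≈ₐ α f) (sym same) (≈ₐ-sym {α = α f} {arc D (Any.index f∈D)} f≈D)))))
      by-index (no different) = Uncrossed-resp-≈ₐ (≈ₐ-sym {α = α e} {arc D (Any.index e∈D)} e≈D)
                                                  (≈ₐ-sym {α = α f} {arc D (Any.index f∈D)} f≈D)
                                  (DiagramUncrossed.arcs-uncrossed D different)

canonical⇒uncrossed : ∀ {n} (J : List (Perm n)) (J-ji : All JoinIrreducible J) → Distinct J →
  Σ[ x ∈ Perm n ] IsCanonicalJoinRep J x → PairwiseUncrossed J J-ji
canonical⇒uncrossed J J-ji J-distinct =
  compatible⇒uncrossed J J-ji J-distinct ∘ diagram⇒compatible J J-ji ∘ canonical⇒diagram J J-ji J-distinct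

module _ {n} (J : List (Perm n)) (J-ji : All JoinIrreducible J) (J-distinct : Distinct J) where
  private
    pair : Fin (length J) → Fin (length J) → List (Perm n)
    pair e f = lookup J e ∷ lookup J f ∷ []

    pair-ji : ∀ e f → All JoinIrreducible (pair e f)
    pair-ji e f = All-lookup J-ji e ∷ All-lookup J-ji f ∷ []

    pair-distinct : ∀ {e f} → e ≢ f → Distinct (pair e f)
    pair-distinct e≢f = (Distinct-lookup J-distinct e≢f ∷ []) , [] , tt

    pair-uncrossed : ∀ {e f} → Uncrossed (arcAt J J-ji e) (arcAt J J-ji f) → PairwiseUncrossed (pair e f) (pair-ji e f)
    pair-uncrossed {e} {f} e-f = pairwiseUncrossed-from-< (pair e f) (pair-ji e f) first<second
      where
      first<second : ∀ {i j : Fin 2} → i < j → Uncrossed (arcAt (pair e f) (pair-ji e f) i) (arcAt (pair e f) (pair-ji e f) j)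
      first<second {zero} {suc zero} _ = e-f
      first<second {suc zero} {suc zero} (s≤s ())

  canonical⇒pairs-canonical : Σ[ x ∈ Perm n ] IsCanonicalJoinRep J x →
                              AllPairs (λ u v → Σ[ x ∈ Perm n ] IsCanonicalJoinRep (u ∷ v ∷ []) x) J
  canonical⇒pairs-canonical J-canonical = AllPairs-tabulate λ {e} {f} e<f →
    uncrossed⇒canonical (pair e f) (pair-ji e f) (pair-uncrossed (canonical⇒uncrossed J J-ji J-distinct J-canonical (Finₚ.<⇒≢ e<f)))

  pairs-canonical⇒uncrossed : AllPairs (λ u v → Σ[ x ∈ Perm n ] IsCanonicalJoinRep (u ∷ v ∷ []) x) J → PairwiseUncrossed J J-ji
  pairs-canonical⇒uncrossed pairs-canonical = pairwiseUncrossed-from-< J J-ji λ {e} {f} e<f →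
    canonical⇒uncrossed (pair e f) (pair-ji e f) (pair-distinct (Finₚ.<⇒≢ e<f)) (AllPairs-lookup pairs-canonical e<f)
                        {zero} {suc zero} (λ ())

corollary3p5 : ∀ {n : ℕ} (J : List (Perm n)) (ji : All JoinIrreducible J) → Distinct J →
    let E = arcsOf J ji
        i = Σ[ x ∈ Perm n ] IsCanonicalJoinRep J x
        ii = Σ[ D ∈ NoncrossingArcDiagram n ] Pointwise _≈ₐ_ (arcs D) E
        iii = AllPairs Compatible E
        iv = AllPairs (λ u v → Σ[ x ∈ Perm n ] IsCanonicalJoinRep (u ∷ v ∷ []) x) J
    in (i ⇔ ii) × (i ⇔ iii) × (i ⇔ iv)
corollary3p5 J ji distinct =
    mk⇔ i⇒ii (iii⇒i ∘ ii⇒iii)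
  , mk⇔ (ii⇒iii ∘ i⇒ii) iii⇒i
  , mk⇔ (canonical⇒pairs-canonical J ji distinct) (uncrossed⇒canonical J ji ∘ pairs-canonical⇒uncrossed J ji distinct)
  where
  i⇒ii = canonical⇒diagram J ji distinct
  ii⇒iii = diagram⇒compatible J ji
  iii⇒i = uncrossed⇒canonical J ji ∘ compatible⇒uncrossed J ji distinct
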